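{- Let $K$ be a real quadratic field of odd discriminant $D$, $\mathfrak{a}\subseteq\mathcal{O}_K$ an integral ideal coprime to $D$, and $m\in\mathbb{Z}\setminus\{0\}$. Then for all $s\in\mathbb{C}$ \[\sum_{d\mid m,\ d>0}d^s\prod_{p\mid D}\big(\chi_{D(p)}(d)+\chi_{D(p)}(N(\mathfrak{a})m/d)\big)=\sum_{D_1D_2=D}\chi_{D_1}(m_{D_2})\,\chi_{D_2}(N(\mathfrak{a})m_0m_{D_1})\,m_{D_2}^{s}\prod_{p\nmid D}\frac{1-(\chi_D(p)p^s)^{\nu_p(m)+1}}{1-\chi_D(p)p^s}.\]
   Context: $D>0$ odd fundamental discriminant, $N$ the absolute norm, $\nu_p$ the $p$-adic valuation. For a prime $p\mid D$, $D(p)\in\{p,-p\}$ with $D(p)\equiv1\pmod4$. For a discriminant $D'$, $\chi_{D'}(n)=\left(\frac{D'}{n}\right)$ is the Kronecker symbol (with $\chi_{D'}(-1)=\operatorname{sgn}D'$). The outer sum on the right runs over all ordered factorizations $D=D_1D_2$ into two discriminants, i.e. $D_i=\prod_{p\in S_i}D(p)$ for a partition of the primes dividing $D$ into sets $S_1,S_2$. For such a factorization, $m_{D_i}:=\prod_{p\mid D_i}p^{\nu_p(m)}$ and $m_0:=m/(m_{D_1}m_{D_2})$ (which carries the sign of $m$). The factor $\frac{1-x^{\nu+1}}{1-x}$ means $1+x+\dots+x^\nu$; it equals $1$ for $p\nmid m$, so the product is finite. -}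

module Defs where

open import Level using (Level)
open import Data.Bool using (Bool; true; false; if_then_else_)
open import Data.Nat as ℕ using (ℕ; zero; suc)
open import Data.Nat.Divisibility using (_∣_; _∣?_)
open import Data.Nat.Primality using (Prime; prime?)
open import Data.Integer as ℤ using (ℤ; +_; -[1+_]; ∣_∣)
open import Data.List using (List; []; _∷_; map; foldr; filter; applyUpTo)
open import Data.Product using (_×_; _,_)
open import Relation.Nullary using (does)
open import Relation.Nullary.Decidable using (_×-dec_)
open import Algebra.Bundles using (CommutativeRing)

-- Exact-division helper (divisor 0 returns 0; only used with d > 0).
divℤ : ℤ → ℕ → ℤ
divℤ a zero    = + 0
divℤ a (suc k) = a ℤ./ℕ suc k

divℕ : ℕ → ℕ → ℕ
divℕ a zero    = 0
divℕ a (suc k) = a ℕ./ suc k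

modℕ : ℕ → ℕ → ℕ
modℕ a zero    = a
modℕ a (suc k) = a ℕ.% suc k

range1 : ℕ → List ℕ
range1 n = applyUpTo suc n

divisorsℕ : ℕ → List ℕ
divisorsℕ n = filter (λ d → d ∣? n) (range1 n)

primesUpTo : ℕ → List ℕ
primesUpTo n = filter prime? (range1 n)

primeDivisors : ℕ → List ℕ
primeDivisors n = filter (λ p → prime? p ×-dec (p ∣? n)) (range1 n)

-- p-adic valuation ν_p(n) (with fuel n; ν_p(0) := 0, only used for n ≠ 0)
valGo : ℕ → ℕ → ℕ → ℕ
valGo zero    q n = 0
valGo (suc f) zero n = 0
valGo (suc f) (suc zero) n = 0
valGo (suc f) q@(suc (suc _)) n =
  if does (q ∣? n) then suc (valGo f q (divℕ n q)) else 0

ν : ℕ → ℕ → ℕ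
ν p n = valGo n p n

νℤ : ℕ → ℤ → ℕ
νℤ p m = ν p ∣ m ∣

-- Legendre symbol (a / q) for an odd prime q, via Euler's criterion.
legendre : ℤ → ℕ → ℤ
legendre a zero = + 0
legendre a q@(suc _) with modℕ (((a ℤ.%ℕ q) ℕ.^ divℕ (q ℕ.∸ 1) 2)) q
... | zero     = + 0
... | suc zero = + 1
... | suc (suc _) = ℤ.- (+ 1)

kronPrime : ℤ → ℕ → ℤ
kronPrime a (suc (suc zero)) with a ℤ.%ℕ 8
... | 1 = + 1
... | 7 = + 1
... | 3 = ℤ.- (+ 1)
... | 5 = ℤ.- (+ 1)
... | _ = + 0
kronPrime a q = legendre a q

-- The unit part: (a / -1) = -1 if a < 0, else 1.
kronSign : ℤ → ℤ → ℤ
kronSign -[1+ _ ] -[1+ _ ] = ℤ.- (+ 1)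
kronSign _        _        = + 1

prodℤ : List ℤ → ℤ
prodℤ = foldr ℤ._*_ (+ 1)

kronecker : ℤ → ℤ → ℤ
kronecker a (+ zero) = if does (∣ a ∣ ℕ.≟ 1) then + 1 else + 0
kronecker a n =
  kronSign a n ℤ.* prodℤ (map (λ q → kronPrime a q ℤ.^ ν q ∣ n ∣) (primesUpTo ∣ n ∣))

χ : ℤ → ℤ → ℤ
χ D' n = kronecker D' n

RealOddFundDisc : ℕ → Set
RealOddFundDisc D =
  (1 ℕ.< D) × (D ℕ.% 4 ≡ 1) × (∀ p → Prime p → p ℕ.* p ∣ D → ⊥)
  where
  open import Relation.Binary.PropositionalEquality using (_≡_)
  open import Data.Empty using (⊥)

-- D(p) ∈ {p, -p} with D(p) ≡ 1 (mod 4)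
Dp : ℕ → ℤ
Dp p = if does (p ℕ.% 4 ℕ.≟ 1) then + p else ℤ.- (+ p)

splits : List ℕ → List (List ℕ × List ℕ)
splits [] = ([] , []) ∷ []
splits (p ∷ ps) =
  foldr (λ { (s₁ , s₂) acc → (p ∷ s₁ , s₂) ∷ (s₁ , p ∷ s₂) ∷ acc }) [] (splits ps)

discOf : List ℕ → ℤ
discOf S = prodℤ (map Dp S)

mPart : List ℕ → ℤ → ℕ
mPart S m = foldr ℕ._*_ 1 (map (λ p → p ℕ.^ νℤ p m) S)

-- The two sides, with d^s replaced by a completely multiplicative
-- function f with values in a commutative ring.

module Sides {c ℓ : Level} (R : CommutativeRing c ℓ) where
  open CommutativeRing R

  ιℕ : ℕ → Carrier
  ιℕ zero    = 0#
  ιℕ (suc n) = 1# + ιℕ n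

  ι : ℤ → Carrier
  ι (+ n)     = ιℕ n
  ι -[1+ n ]  = - ιℕ (suc n)

  Σ' : List Carrier → Carrier
  Σ' = foldr _+_ 0#

  Π' : List Carrier → Carrier
  Π' = foldr _*_ 1#

  pow : Carrier → ℕ → Carrier
  pow x zero    = 1#
  pow x (suc k) = x * pow x k

  -- 1 + x + ... + x^ν  (= (1 - x^{ν+1}) / (1 - x))
  geom : Carrier → ℕ → Carrier
  geom x k = Σ' (map (pow x) (applyUpTo (λ i → i) (suc k)))

  LHS : (ℕ → Carrier) → ℕ → ℕ → ℤ → Carrier
  LHS f D N m =
    Σ' (map (λ d → f d * Π' (map (λ p →
             ι (χ (Dp p) (+ d)) + ι (χ (Dp p) (divℤ (+ N ℤ.* m) d)))
           (primeDivisors D)))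
         (divisorsℕ ∣ m ∣))

  term : (ℕ → Carrier) → ℕ → ℕ → ℤ → List ℕ × List ℕ → Carrier
  term f D N m (S₁ , S₂) =
    ι (χ D₁ (+ m₂)) * ι (χ D₂ (+ N ℤ.* m₀ ℤ.* + m₁)) * f m₂ *
      Π' (map (λ p → geom (ι (χ (+ D) (+ p)) * f p) (νℤ p m))
              (filter (λ p → Relation.Nullary.¬? (p ∣? D)) (primesUpTo ∣ m ∣)))
    where
    import Relation.Nullary
    D₁ = discOf S₁
    D₂ = discOf S₂
    m₁ = mPart S₁ m
    m₂ = mPart S₂ m
    m₀ = divℤ m (m₁ ℕ.* m₂)

  RHS : (ℕ → Carrier) → ℕ → ℕ → ℤ → Carrier
  RHS f D N m = Σ' (map (term f D N m) (splits (primeDivisors D)))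

module Submission where

-- Expanding ∏_{p ∣ D} (χ_{D(p)}(d) + χ_{D(p)}(N m/d)) over the splittings D = D₁D₂ (the product
-- of the D(p) over a set of primes is D₁, by multiplicativity of the Kronecker symbol in its upper
-- argument) and exchanging the two sums turns the left side into
-- Σ_{D₁D₂=D} Σ_{d ∣ m} f(d) χ_{D₁}(d) χ_{D₂}(N m/d). For a fixed splitting write N m/d = C·(|m|/d)
-- with C = sgn(m) N; then χ_{D₂}(C) factors out and, f and both characters being completely
-- multiplicative on positive integers, the inner sum is a sum over d ∣ |m| of products over the
-- primes q ≤ |m| of local terms depending only on ν_q(d). It therefore factors into a product over q
-- of local sums over 0 ≤ i ≤ ν_q(m), which are evaluated separately according as q divides D₁, D₂
-- or neither: in the first two cases one character vanishes at q and a single term survives; in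
-- the last, χ_{D₂}(q)² = 1 turns the local sum into χ_{D₂}(q)^{ν_q(m)} times a geometric series in
-- χ_D(q) f(q). Multiplicativity of (a / q) in a rests on Euler's criterion, i.e. on Fermat's little
-- theorem, and for q = 2 on a table modulo 8; the product of all D(p) is D (rather than -D) because
-- both are 1 modulo 4.

open import Algebra.Bundles using (CommutativeMonoid; CommutativeSemiring; CommutativeRing)

module ListFacts where

  open import Defs using (splits)

  open import Data.Nat using (ℕ)
  open import Data.List using (List; []; _∷_; _++_; concatMap; foldr)
  open import Data.List.Membership.Propositional using (_∈_; _∉_; find)
  open import Data.List.Membership.Propositional.Properties using (∈-concatMap⁻)
  open import Data.List.Membership.Propositional.Properties.WithK using (unique∧set⇒bag)
  open import Data.List.Relation.Binary.BagAndSetEquality using (∼bag⇒↭)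
  open import Data.List.Relation.Binary.Permutation.Propositional using (_↭_; ↭-refl; ↭-prep; ↭-trans)
  open import Data.List.Relation.Binary.Permutation.Propositional.Properties using (shift)
  open import Data.List.Relation.Unary.All using (_∷_)
  open import Data.List.Relation.Unary.All.Properties using (All¬⇒¬Any; ++⁻)
  open import Data.List.Relation.Unary.Any using (here; there)
  open import Data.List.Relation.Unary.Unique.Propositional using (Unique; []; _∷_)
  import Data.List.Relation.Unary.Unique.Propositional.Properties as Unique
  open import Data.Empty using (⊥)
  open import Data.Product using (_×_; _,_; proj₁; proj₂)
  open import Function using (_∘_)
  open import Function.Bundles using (mk⇔)
  open import Relation.Binary.PropositionalEquality using (_≡_; refl)

  module _ {A : Set} where

    unique-∈⇔⇒↭ : {xs ys : List A} → Unique xs → Unique ys →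
                  (∀ {z} → z ∈ xs → z ∈ ys) → (∀ {z} → z ∈ ys → z ∈ xs) → xs ↭ ys
    unique-∈⇔⇒↭ ux uy to from = ∼bag⇒↭ (unique∧set⇒bag ux uy (mk⇔ to from))

    Unique-++⁻ : ∀ xs {ys : List A} → Unique (xs ++ ys) →
                 Unique xs × Unique ys × (∀ {z} → z ∈ xs → z ∉ ys)
    Unique-++⁻ []       u        = [] , u , λ ()
    Unique-++⁻ (x ∷ xs) (x∉ ∷ u) with Unique-++⁻ xs u | ++⁻ xs x∉
    ... | uxs , uys , disj | x∉xs , x∉ys =
      x∉xs ∷ uxs , uys , λ { (here refl) → All¬⇒¬Any x∉ys ; (there z∈) → disj z∈ }

  module _ {A B : Set} where

    unique-concatMap : (g : A → List B) {is : List A} → Unique is → (∀ i → Unique (g i)) →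
                       (∀ {i j x} → x ∈ g i → x ∈ g j → i ≡ j) → Unique (concatMap g is)
    unique-concatMap g {[]}     _         _  _        = []
    unique-concatMap g {i ∷ is} (i∉ ∷ u) ug injective =
      Unique.++⁺ (ug i) (unique-concatMap g u ug injective) disjoint
      where
      disjoint : ∀ {x} → x ∈ g i × x ∈ concatMap g is → ⊥
      disjoint (x∈i , x∈is) with find (∈-concatMap⁻ g {xs = is} x∈is)
      ... | j , j∈ , x∈j with injective x∈i x∈j
      ... | refl = All¬⇒¬Any i∉ j∈

  ∈-splits⇒↭ : ∀ ps {s} → s ∈ splits ps → proj₁ s ++ proj₂ s ↭ ps
  ∈-splits⇒↭ []       (here refl) = ↭-refl
  ∈-splits⇒↭ (p ∷ ps)             = go (splits ps) (∈-splits⇒↭ ps)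
    where
    extend : List ℕ × List ℕ → List (List ℕ × List ℕ) → List (List ℕ × List ℕ)
    extend s acc = (p ∷ proj₁ s , proj₂ s) ∷ (proj₁ s , p ∷ proj₂ s) ∷ acc
    go : ∀ ss → (∀ {t} → t ∈ ss → proj₁ t ++ proj₂ t ↭ ps) →
         ∀ {s} → s ∈ foldr extend [] ss → proj₁ s ++ proj₂ s ↭ p ∷ ps
    go (t ∷ ss) ih (here refl)         = ↭-prep p (ih (here refl))
    go (t ∷ ss) ih (there (here refl)) = ↭-trans (shift p (proj₁ t) (proj₂ t)) (↭-prep p (ih (here refl)))
    go (t ∷ ss) ih (there (there s∈))  = go ss (ih ∘ there) s∈

module ListProduct {c ℓ} (CM : CommutativeMonoid c ℓ) where

  open import Level using (Level)
  open import Data.Bool using (true; false; if_then_else_)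
  open import Data.List using (List; []; _∷_; map; foldr; filter; _++_; concatMap)
  open import Data.List.Membership.Propositional using (_∈_)
  open import Data.List.Relation.Binary.Permutation.Propositional using (_↭_; ↭⇒↭ₛ′)
  open import Data.List.Relation.Binary.Permutation.Propositional.Properties using (map⁺)
  import Data.List.Relation.Binary.Permutation.Setoid.Properties as PermutationProperties
  open import Data.List.Relation.Unary.All.Properties using (All¬⇒¬Any)
  open import Data.List.Relation.Unary.Any using (here; there)
  open import Data.List.Relation.Unary.Unique.Propositional using (Unique; _∷_)
  open import Function using (_∘_)
  open import Relation.Binary.PropositionalEquality as ≡ using (_≢_)
  open import Relation.Nullary using (does)
  open import Relation.Unary using (Pred; Decidable)

  open CommutativeMonoid CM renaming (Carrier to C)
  open import Algebra.Properties.CommutativeSemigroup commutativeSemigroup using (interchange)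
  open import Relation.Binary.Reasoning.Setoid setoid

  private
    variable
      b : Level
      B : Set b

  ∏ : (B → C) → List B → C
  ∏ f xs = foldr _∙_ ε (map f xs)

  ∏-cong : ∀ {f g : B → C} xs → (∀ {x} → x ∈ xs → f x ≈ g x) → ∏ f xs ≈ ∏ g xs
  ∏-cong []       f≈g = refl
  ∏-cong (x ∷ xs) f≈g = ∙-cong (f≈g (here ≡.refl)) (∏-cong xs (f≈g ∘ there))

  ∏-ε : ∀ {f : B → C} xs → (∀ {x} → x ∈ xs → f x ≈ ε) → ∏ f xs ≈ ε
  ∏-ε []       f≈ε = refl
  ∏-ε (x ∷ xs) f≈ε = trans (∙-cong (f≈ε (here ≡.refl)) (∏-ε xs (f≈ε ∘ there))) (identityˡ ε)

  ∏-∙ : ∀ (f g : B → C) xs → ∏ (λ x → f x ∙ g x) xs ≈ ∏ f xs ∙ ∏ g xs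
  ∏-∙ f g []       = sym (identityˡ ε)
  ∏-∙ f g (x ∷ xs) = trans (∙-congˡ (∏-∙ f g xs)) (interchange (f x) (g x) (∏ f xs) (∏ g xs))

  ∏-↭ : ∀ (f : B → C) {xs ys} → xs ↭ ys → ∏ f xs ≈ ∏ f ys
  ∏-↭ f xs↭ys = foldr-commMonoid isCommutativeMonoid (↭⇒↭ₛ′ isEquivalence (map⁺ f xs↭ys))
    where open PermutationProperties setoid using (foldr-commMonoid)

  ∏-++ : ∀ (f : B → C) xs ys → ∏ f (xs ++ ys) ≈ ∏ f xs ∙ ∏ f ys
  ∏-++ f []       ys = sym (identityˡ _)
  ∏-++ f (x ∷ xs) ys = trans (∙-congˡ (∏-++ f xs ys)) (sym (assoc _ _ _))

  ∏-filter : ∀ {p} {P : Pred B p} (P? : Decidable P) (f : B → C) xs →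
             ∏ f (filter P? xs) ≈ ∏ (λ x → if does (P? x) then f x else ε) xs
  ∏-filter P? f []       = refl
  ∏-filter P? f (x ∷ xs) with does (P? x)
  ... | true  = ∙-congˡ (∏-filter P? f xs)
  ... | false = trans (∏-filter P? f xs) (sym (identityˡ _))

  ∏-map : ∀ {d} {D : Set d} (f : D → C) (g : B → D) xs → ∏ f (map g xs) ≈ ∏ (f ∘ g) xs
  ∏-map f g []       = refl
  ∏-map f g (x ∷ xs) = ∙-congˡ (∏-map f g xs)

  ∏-concatMap : ∀ {d} {D : Set d} (f : D → C) (g : B → List D) xs →
                ∏ f (concatMap g xs) ≈ ∏ (λ x → ∏ f (g x)) xs
  ∏-concatMap f g []       = refl
  ∏-concatMap f g (x ∷ xs) = trans (∏-++ f (g x) (concatMap g xs)) (∙-congˡ (∏-concatMap f g xs))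

  ∏-support-single : ∀ (f : B → C) {xs x} → Unique xs → x ∈ xs →
                     (∀ {y} → y ∈ xs → y ≢ x → f y ≈ ε) → ∏ f xs ≈ f x
  ∏-support-single f {x ∷ xs} (x∉ ∷ u) (here ≡.refl) f≈ε =
    trans (∙-congˡ (∏-ε xs λ y∈ → f≈ε (there y∈) λ { ≡.refl → All¬⇒¬Any x∉ y∈ })) (identityʳ _)
  ∏-support-single f {y ∷ xs} (y∉ ∷ u) (there x∈) f≈ε =
    trans (∙-cong (f≈ε (here ≡.refl) λ { ≡.refl → All¬⇒¬Any y∉ x∈ }) (∏-support-single f u x∈ (f≈ε ∘ there)))
          (identityˡ _)

module SemiringSum {c ℓ} (S : CommutativeSemiring c ℓ) where

  open import Defs using (splits)
  open import Level using (Level)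
  open import Data.Nat using (ℕ)
  open import Data.List using (List; []; _∷_; foldr)
  open import Data.Product using (_×_; _,_; proj₁; proj₂)

  open CommutativeSemiring S
  open import Relation.Binary.Reasoning.Setoid setoid
  open import Algebra.Properties.CommutativeSemigroup *-commutativeSemigroup using (x∙yz≈y∙xz)

  open ListProduct +-commutativeMonoid public
    renaming (∏ to ∑; ∏-cong to ∑-cong; ∏-ε to ∑-0; ∏-∙ to ∑-+; ∏-↭ to ∑-↭; ∏-++ to ∑-++;
              ∏-map to ∑-map; ∏-concatMap to ∑-concatMap)
    using ()
  open ListProduct *-commutativeMonoid public
    using (∏; ∏-cong; ∏-ε; ∏-∙; ∏-↭; ∏-++; ∏-filter; ∏-support-single)

  private
    variable
      a : Level
      A B : Set a

  ∑-distribˡ : ∀ x (f : A → Carrier) xs → x * ∑ f xs ≈ ∑ (λ y → x * f y) xs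
  ∑-distribˡ x f []       = zeroʳ x
  ∑-distribˡ x f (y ∷ xs) = trans (distribˡ x (f y) (∑ f xs)) (+-congˡ (∑-distribˡ x f xs))

  ∑-distribʳ : ∀ x (f : A → Carrier) xs → ∑ f xs * x ≈ ∑ (λ y → f y * x) xs
  ∑-distribʳ x f []       = zeroˡ x
  ∑-distribʳ x f (y ∷ xs) = trans (distribʳ x (f y) (∑ f xs)) (+-congˡ (∑-distribʳ x f xs))

  ∑-comm : ∀ (F : A → B → Carrier) xs ys → ∑ (λ x → ∑ (F x) ys) xs ≈ ∑ (λ y → ∑ (λ x → F x y) xs) ys
  ∑-comm F []       ys = sym (∑-0 ys (λ _ → refl))
  ∑-comm F (x ∷ xs) ys = trans (+-congˡ (∑-comm F xs ys)) (sym (∑-+ (F x) (λ y → ∑ (λ x → F x y) xs) ys))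

  ∏-+-splits : ∀ (f g : ℕ → Carrier) ps →
               ∏ (λ p → f p + g p) ps ≈ ∑ (λ s → ∏ f (proj₁ s) * ∏ g (proj₂ s)) (splits ps)
  ∏-+-splits f g []       = sym (trans (+-identityʳ _) (*-identityˡ _))
  ∏-+-splits f g (p ∷ ps) = trans (*-congˡ (∏-+-splits f g ps)) (sym (step (splits ps)))
    where
    term : List ℕ × List ℕ → Carrier
    term s = ∏ f (proj₁ s) * ∏ g (proj₂ s)
    extend : List ℕ × List ℕ → List (List ℕ × List ℕ) → List (List ℕ × List ℕ)
    extend s acc = (p ∷ proj₁ s , proj₂ s) ∷ (proj₁ s , p ∷ proj₂ s) ∷ acc
    step : ∀ ss → ∑ term (foldr extend [] ss) ≈ (f p + g p) * ∑ term ss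
    step []               = sym (zeroʳ _)
    step ((s₁ , s₂) ∷ ss) = begin
      (f p * ∏ f s₁) * ∏ g s₂ + (∏ f s₁ * (g p * ∏ g s₂) + ∑ term (foldr extend [] ss))
        ≈⟨ +-cong (*-assoc _ _ _) (+-cong (x∙yz≈y∙xz _ _ _) (step ss)) ⟩
      f p * t + (g p * t + (f p + g p) * ∑ term ss)   ≈⟨ sym (+-assoc _ _ _) ⟩
      (f p * t + g p * t) + (f p + g p) * ∑ term ss   ≈⟨ +-congʳ (sym (distribʳ _ _ _)) ⟩
      (f p + g p) * t + (f p + g p) * ∑ term ss       ≈⟨ sym (distribˡ _ _ _) ⟩
      (f p + g p) * (t + ∑ term ss)                   ∎
      where
      t : Carrier
      t = term (s₁ , s₂)

module Primes where

  open import Defs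
  open import Data.Nat as ℕ using (ℕ; zero; suc; _+_; _*_; _^_; _≤_; _<_; z≤n; s≤s)
  open import Data.Nat.Properties
  open import Data.Nat.Coprimality using (Coprime; coprime-divisor)
  open import Data.Nat.Divisibility
  open import Data.Nat.ListAction using (product)
  open import Data.Nat.Primality using (Prime; prime?; euclidsLemma; prime⇒nonTrivial; prime⇒irreducible)
  open import Data.Nat.Primality.Factorisation using (factorise)
  open import Data.Empty using (⊥-elim)
  open import Function using (_∘_)
  open import Data.List using ([]; _∷_)
  open import Data.List.Membership.Propositional using (_∈_)
  open import Data.List.Membership.Propositional.Properties using (∈-applyUpTo⁻; ∈-applyUpTo⁺; ∈-filter⁻; ∈-filter⁺)
  open import Data.List.Relation.Unary.All using (All; _∷_)
  open import Data.List.Relation.Unary.Any using (here; there)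
  open import Data.List.Relation.Unary.Unique.Propositional using (Unique)
  import Data.List.Relation.Unary.Unique.Propositional.Properties as Unique
  open import Data.Product using (_×_; _,_; proj₁; proj₂; ∃)
  open import Data.Sum using (inj₁; inj₂)
  open import Relation.Nullary using (¬_)
  open import Relation.Nullary.Decidable using (_×-dec_)
  open import Relation.Binary.PropositionalEquality using (_≡_; _≢_; refl; trans; subst)

  prime⇒≡2+ : ∀ {p} → Prime p → ∃ λ k → p ≡ 2 + k
  prime⇒≡2+ {p} pp with ℕ.nonTrivial⇒n>1 p {{prime⇒nonTrivial pp}}
  ... | s≤s (s≤s _) with p
  ... | suc (suc k) = k , refl

  prime⇒1<p : ∀ {p} → Prime p → 1 < p
  prime⇒1<p {p} pp = ℕ.nonTrivial⇒n>1 p {{prime⇒nonTrivial pp}}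

  prime⇒pos : ∀ {p} → Prime p → 0 < p
  prime⇒pos pp with prime⇒≡2+ pp
  ... | _ , refl = s≤s z≤n

  prime∣prime⇒≡ : ∀ {p q} → Prime p → Prime q → q ∣ p → q ≡ p
  prime∣prime⇒≡ pp pq q∣p with prime⇒irreducible pp q∣p
  ... | inj₂ q≡p = q≡p
  ... | inj₁ refl with prime⇒≡2+ pq
  ... | _ , ()

  prime∤1 : ∀ {q} → Prime q → ¬ (q ∣ 1)
  prime∤1 pq q∣1 with prime⇒≡2+ pq | ∣1⇒≡1 q∣1
  ... | _ , refl | ()

  prime∤prime^ : ∀ {p q} → Prime p → Prime q → q ≢ p → ∀ k → ¬ (q ∣ p ^ k)
  prime∤prime^ pp pq q≢p zero    q∣1 = prime∤1 pq q∣1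
  prime∤prime^ pp pq q≢p (suc k) q∣p^k+1 with euclidsLemma _ _ pq q∣p^k+1
  ... | inj₁ q∣p   = q≢p (prime∣prime⇒≡ pp pq q∣p)
  ... | inj₂ q∣p^k = prime∤prime^ pp pq q≢p k q∣p^k

  prime∣product⇒∈ : ∀ {q S} → Prime q → All Prime S → q ∣ product S → q ∈ S
  prime∣product⇒∈ {S = []}    pq _              q∣1 = ⊥-elim (prime∤1 pq q∣1)
  prime∣product⇒∈ {S = p ∷ S} pq (pp ∷ primes) q∣ with euclidsLemma p (product S) pq q∣
  ... | inj₁ q∣p = here (prime∣prime⇒≡ pp pq q∣p)
  ... | inj₂ q∣Π = there (prime∣product⇒∈ pq primes q∣Π)

  prime∤⇒coprime : ∀ {q d} → Prime q → ¬ (q ∣ d) → Coprime d q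
  prime∤⇒coprime pq q∤d (i∣d , i∣q) with prime⇒irreducible pq i∣q
  ... | inj₁ i≡1 = i≡1
  ... | inj₂ refl = ⊥-elim (q∤d i∣d)

  ∣prime^*⇒∣ : ∀ {q d} → Prime q → ¬ (q ∣ d) → ∀ k {n} → d ∣ q ^ k * n → d ∣ n
  ∣prime^*⇒∣ pq q∤d zero    {n} d∣ = subst (_ ∣_) (*-identityˡ n) d∣
  ∣prime^*⇒∣ {q} {d} pq q∤d (suc k) {n} d∣ =
    ∣prime^*⇒∣ pq q∤d k (coprime-divisor (prime∤⇒coprime pq q∤d) (subst (d ∣_) (*-assoc q (q ^ k) n) d∣))

  no-prime-divisor⇒≡1 : ∀ n → 0 < n → (∀ p → Prime p → ¬ (p ∣ n)) → n ≡ 1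
  no-prime-divisor⇒≡1 (suc zero)    _ _ = refl
  no-prime-divisor⇒≡1 n@(suc (suc _)) _ no-divisor with factorise n
  ... | record { factors = [] ; isFactorisation = () }
  ... | record { factors = p ∷ ps ; isFactorisation = n≡p*Πps ; factorsPrime = pp ∷ _ } =
    ⊥-elim (no-divisor p pp (divides (product ps) (trans n≡p*Πps (*-comm p (product ps)))))

  ∈-range1⁻ : ∀ {d n} → d ∈ range1 n → 0 < d × d ≤ n
  ∈-range1⁻ d∈ with ∈-applyUpTo⁻ suc d∈
  ... | i , i<n , refl = s≤s z≤n , i<n

  ∈-range1⁺ : ∀ {d n} → 0 < d → d ≤ n → d ∈ range1 n
  ∈-range1⁺ {suc d} _ d≤n = ∈-applyUpTo⁺ suc d≤n

  unique-range1 : ∀ n → Unique (range1 n)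
  unique-range1 n = Unique.applyUpTo⁺₁ suc n (λ i<j _ → <⇒≢ i<j ∘ suc-injective)

  ∈-divisorsℕ⁻ : ∀ {d n} → d ∈ divisorsℕ n → d ∣ n × 0 < d
  ∈-divisorsℕ⁻ {d} {n} d∈ with ∈-filter⁻ (_∣? n) {xs = range1 n} d∈
  ... | d∈range , d∣n = d∣n , proj₁ (∈-range1⁻ d∈range)

  ∈-divisorsℕ⁺ : ∀ {d n} → 0 < n → d ∣ n → 0 < d → d ∈ divisorsℕ n
  ∈-divisorsℕ⁺ {d} {suc n} _ d∣n 0<d = ∈-filter⁺ (_∣? suc n) (∈-range1⁺ 0<d (∣⇒≤ d∣n)) d∣n

  unique-divisorsℕ : ∀ n → Unique (divisorsℕ n)
  unique-divisorsℕ n = Unique.filter⁺ (_∣? n) (unique-range1 n)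

  ∈-primesUpTo⁻ : ∀ {p n} → p ∈ primesUpTo n → Prime p × p ≤ n
  ∈-primesUpTo⁻ {p} {n} p∈ with ∈-filter⁻ prime? {xs = range1 n} p∈
  ... | p∈range , pp = pp , proj₂ (∈-range1⁻ p∈range)

  ∈-primesUpTo⁺ : ∀ {p n} → Prime p → p ≤ n → p ∈ primesUpTo n
  ∈-primesUpTo⁺ pp p≤n = ∈-filter⁺ prime? (∈-range1⁺ (prime⇒pos pp) p≤n) pp

  unique-primesUpTo : ∀ n → Unique (primesUpTo n)
  unique-primesUpTo n = Unique.filter⁺ prime? (unique-range1 n)

  ∈-primeDivisors⁻ : ∀ {p n} → p ∈ primeDivisors n → Prime p × p ∣ n
  ∈-primeDivisors⁻ {p} {n} p∈ = proj₂ (∈-filter⁻ (λ p → prime? p ×-dec (p ∣? n)) {xs = range1 n} p∈)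

  ∈-primeDivisors⁺ : ∀ {p n} → 0 < n → Prime p → p ∣ n → p ∈ primeDivisors n
  ∈-primeDivisors⁺ {p} {suc n} _ pp p∣n =
    ∈-filter⁺ (λ p → prime? p ×-dec (p ∣? suc n)) (∈-range1⁺ (prime⇒pos pp) (∣⇒≤ p∣n)) (pp , p∣n)

  unique-primeDivisors : ∀ n → Unique (primeDivisors n)
  unique-primeDivisors n = Unique.filter⁺ (λ p → prime? p ×-dec (p ∣? n)) (unique-range1 n)

module Valuation where

  open import Defs
  open Primes
  open import Data.Nat as ℕ using (ℕ; zero; suc; _+_; _*_; _^_; _≤_; _<_; _∸_; z≤n; s≤s)
  open import Data.Nat.Properties
  open import Data.Nat.Divisibility
  open import Data.Nat.DivMod using (m*n/n≡m; _/_)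
  open import Data.Nat.Primality using (Prime; euclidsLemma; prime⇒nonZero)
  open import Data.Nat.Solver using (module +-*-Solver)
  open import Data.Bool using (if_then_else_)
  open import Data.Empty using (⊥-elim)
  open import Data.Product using (_×_; _,_; ∃)
  open import Data.Sum using (inj₁; inj₂)
  open import Relation.Nullary using (¬_; yes; no)
  open import Function using (_∘_)
  open import Relation.Nullary.Decidable using (dec-true; dec-false)
  open import Relation.Binary.PropositionalEquality using (_≡_; _≢_; refl; sym; trans; cong; cong₂; subst; subst₂; module ≡-Reasoning)
  open ≡-Reasoning
  open +-*-Solver

  ∣⇒pos : ∀ {q n} → ¬ (q ∣ n) → 0 < n
  ∣⇒pos {n = zero}  q∤0 = ⊥-elim (q∤0 (divides 0 refl))
  ∣⇒pos {n = suc _} _   = s≤s z≤n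

  *≡pos⇒posˡ : ∀ {n k m} → 0 < n → n ≡ k * m → 0 < k
  *≡pos⇒posˡ {k = zero}  0<n n≡0 = ⊥-elim (<-irrefl (sym n≡0) 0<n)
  *≡pos⇒posˡ {k = suc _} _   _   = s≤s z≤n

  ^-monoʳ-∣ : ∀ q {m n} → m ≤ n → q ^ m ∣ q ^ n
  ^-monoʳ-∣ q {m} {n} m≤n =
    divides (q ^ (n ∸ m)) (trans (cong (q ^_) (sym (m∸n+n≡m m≤n))) (^-distribˡ-+-* q (n ∸ m) m))

  -- valGo only computes for a base of the form 2 + q′, so ν is characterised there and the
  -- result transported to primes below.
  private
    module Base2+ (q′ : ℕ) where
      q : ℕ
      q = 2 + q′

      split-q^ : ∀ fuel n → n ≤ fuel → 0 < n → ∃ λ a → ∃ λ n′ → n ≡ q ^ a * n′ × ¬ (q ∣ n′)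
      split-q^ fuel n n≤fuel 0<n with q ∣? n
      ... | no q∤n = 0 , n , sym (+-identityʳ n) , q∤n
      split-q^ zero n n≤0 0<n | yes _ = ⊥-elim (<-irrefl refl (≤-trans 0<n n≤0))
      split-q^ (suc fuel) n n≤fuel 0<n | yes (divides k n≡k*q) with split-q^ fuel k k≤fuel 0<k
        where
        0<k : 0 < k
        0<k = *≡pos⇒posˡ 0<n n≡k*q
        k<n : k < n
        k<n = subst (k <_) (sym n≡k*q) (m<m*n k q {{ℕ.>-nonZero 0<k}} (s≤s (s≤s z≤n)))
        k≤fuel : k ≤ fuel
        k≤fuel = ≤-pred (≤-trans k<n n≤fuel)
      ... | a , n′ , k≡q^a*n′ , q∤n′ =
        suc a , n′ , trans n≡k*q (trans (cong (_* q) k≡q^a*n′) (reorder a n′)) , q∤n′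
        where
        reorder : ∀ a n′ → q ^ a * n′ * q ≡ q ^ suc a * n′
        reorder a n′ = solve 3 (λ x n q → x :* n :* q := (q :* x) :* n) refl (q ^ a) n′ q

      valGo-∣ : ∀ fuel n → q ∣ n → valGo (suc fuel) q n ≡ suc (valGo fuel q (divℕ n q))
      valGo-∣ fuel n q∣n = cong (λ b → if b then suc (valGo fuel q (divℕ n q)) else 0) (dec-true (q ∣? n) q∣n)

      valGo-∤ : ∀ fuel n → ¬ (q ∣ n) → valGo (suc fuel) q n ≡ 0
      valGo-∤ fuel n q∤n = cong (λ b → if b then suc (valGo fuel q (divℕ n q)) else 0) (dec-false (q ∣? n) q∤n)

      valGo-q^a*n : ∀ fuel a n → ¬ (q ∣ n) → q ^ a * n ≤ fuel → 0 < n → valGo fuel q (q ^ a * n) ≡ a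
      valGo-q^a*n zero a n _ q^a*n≤0 0<n = ⊥-elim (<-irrefl refl (≤-trans (*-mono-≤ (m^n>0 q a) 0<n) q^a*n≤0))
      valGo-q^a*n (suc fuel) zero n q∤n _ _ = valGo-∤ fuel (1 * n) (q∤n ∘ subst (q ∣_) (*-identityˡ n))
      valGo-q^a*n (suc fuel) (suc a) n q∤n q^a+1*n≤ 0<n = begin
        valGo (suc fuel) q (q ^ suc a * n)            ≡⟨ valGo-∣ fuel (q ^ suc a * n) (divides m q^a+1*n≡m*q) ⟩
        suc (valGo fuel q (divℕ (q ^ suc a * n) q))   ≡⟨ cong (λ x → suc (valGo fuel q x)) (trans (cong (_/ q) q^a+1*n≡m*q) (m*n/n≡m m q)) ⟩
        suc (valGo fuel q m)                          ≡⟨ cong suc (valGo-q^a*n fuel a n q∤n m≤fuel 0<n) ⟩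
        suc a                                         ∎
        where
        m : ℕ
        m = q ^ a * n
        q^a+1*n≡m*q : q ^ suc a * n ≡ m * q
        q^a+1*n≡m*q = solve 3 (λ q x n → q :* x :* n := x :* n :* q) refl q (q ^ a) n
        m≤fuel : m ≤ fuel
        m≤fuel = ≤-pred (≤-trans (m<m*n m q {{ℕ.>-nonZero (*-mono-≤ (m^n>0 q a) 0<n)}} (s≤s (s≤s z≤n)))
                                 (subst (_≤ suc fuel) q^a+1*n≡m*q q^a+1*n≤))

  module _ {q} (pq : Prime q) where

    ν-q^a*n : ∀ a n → ¬ (q ∣ n) → 0 < n → ν q (q ^ a * n) ≡ a
    ν-q^a*n a n with prime⇒≡2+ pq
    ... | q′ , refl = λ q∤n 0<n → Base2+.valGo-q^a*n q′ (q ^ a * n) a n q∤n ≤-refl 0<n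

    ν-spec : ∀ n → 0 < n → ∃ λ n′ → n ≡ q ^ ν q n * n′ × ¬ (q ∣ n′) × 0 < n′
    ν-spec n 0<n with prime⇒≡2+ pq
    ... | q′ , refl with Base2+.split-q^ q′ n n ≤-refl 0<n
    ... | a , n′ , n≡q^a*n′ , q∤n′ =
      n′ , trans n≡q^a*n′ (cong (λ a → q ^ a * n′) (sym ν≡a)) , q∤n′ , ∣⇒pos q∤n′
      where
      ν≡a : ν q n ≡ a
      ν≡a = trans (cong (ν q) n≡q^a*n′) (ν-q^a*n a n′ q∤n′ (∣⇒pos q∤n′))

    ν≡0 : ∀ n → ¬ (q ∣ n) → 0 < n → ν q n ≡ 0
    ν≡0 n q∤n 0<n = subst (λ m → ν q m ≡ 0) (*-identityˡ n) (ν-q^a*n 0 n q∤n 0<n)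

    ν-q^ : ∀ k → ν q (q ^ k) ≡ k
    ν-q^ k = subst (λ m → ν q m ≡ k) (*-identityʳ (q ^ k)) (ν-q^a*n k 1 (prime∤1 pq) (s≤s z≤n))

    ν-q : ν q q ≡ 1
    ν-q = subst (λ m → ν q m ≡ 1) (*-identityʳ q) (ν-q^ 1)

    ν-* : ∀ x y → 0 < x → 0 < y → ν q (x * y) ≡ ν q x + ν q y
    ν-* x y 0<x 0<y with ν-spec x 0<x | ν-spec y 0<y
    ... | x′ , x≡ , q∤x′ , 0<x′ | y′ , y≡ , q∤y′ , 0<y′ =
      trans (cong (ν q) x*y≡) (ν-q^a*n (ν q x + ν q y) (x′ * y′) q∤x′*y′ (*-mono-≤ 0<x′ 0<y′))
      where
      x*y≡ : x * y ≡ q ^ (ν q x + ν q y) * (x′ * y′)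
      x*y≡ = begin
        x * y                                     ≡⟨ cong₂ _*_ x≡ y≡ ⟩
        q ^ ν q x * x′ * (q ^ ν q y * y′)         ≡⟨ solve 4 (λ a b c d → (a :* c) :* (b :* d) := (a :* b) :* (c :* d))
                                                             refl (q ^ ν q x) (q ^ ν q y) x′ y′ ⟩
        q ^ ν q x * q ^ ν q y * (x′ * y′)         ≡⟨ cong (_* (x′ * y′)) (sym (^-distribˡ-+-* q (ν q x) (ν q y))) ⟩
        q ^ (ν q x + ν q y) * (x′ * y′)           ∎
      q∤x′*y′ : ¬ (q ∣ x′ * y′)
      q∤x′*y′ q∣ with euclidsLemma x′ y′ pq q∣
      ... | inj₁ q∣x′ = q∤x′ q∣x′
      ... | inj₂ q∣y′ = q∤y′ q∣y′

    q^k∣⇒k≤ν : ∀ k n → 0 < n → q ^ k ∣ n → k ≤ ν q n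
    q^k∣⇒k≤ν k n 0<n q^k∣n with ν-spec n 0<n | k ≤? ν q n
    ... | _ , _ , _ , _ | yes k≤ν = k≤ν
    ... | n′ , n≡ , q∤n′ , _ | no k≰ν = ⊥-elim (q∤n′ (*-cancelˡ-∣ (q ^ ν q n) {{m^n≢0 q (ν q n)}} q^ν*q∣q^ν*n′))
      where
      instance
        q≢0 : ℕ.NonZero q
        q≢0 = prime⇒nonZero pq
      q^ν*q∣q^ν*n′ : q ^ ν q n * q ∣ q ^ ν q n * n′
      q^ν*q∣q^ν*n′ = subst₂ _∣_ (*-comm q (q ^ ν q n)) n≡ (∣-trans (^-monoʳ-∣ q (≰⇒> k≰ν)) q^k∣n)

    k≤ν⇒q^k∣ : ∀ k n → 0 < n → k ≤ ν q n → q ^ k ∣ n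
    k≤ν⇒q^k∣ k n 0<n k≤ν with ν-spec n 0<n
    ... | n′ , n≡ , _ , _ = subst (q ^ k ∣_) (sym n≡) (∣-trans (^-monoʳ-∣ q k≤ν) (m∣m*n n′))

  ν-prime^ : ∀ {p q} → Prime p → Prime q → q ≢ p → ∀ k → ν q (p ^ k) ≡ 0
  ν-prime^ {p} pp pq q≢p k = ν≡0 pq (p ^ k) (prime∤prime^ pp pq q≢p k) (m^n>0 p {{prime⇒nonZero pp}} k)

  ν-prime^* : ∀ {p q} → Prime p → Prime q → q ≢ p → ∀ k n → 0 < n → ν q (p ^ k * n) ≡ ν q n
  ν-prime^* {p} {q} pp pq q≢p k n 0<n =
    trans (ν-* pq (p ^ k) n (m^n>0 p {{prime⇒nonZero pp}} k) 0<n) (cong (_+ ν q n) (ν-prime^ pp pq q≢p k))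

module Divisors where

  open import Defs
  open ListFacts
  open Primes
  open Valuation
  open import Data.Nat as ℕ using (ℕ; suc; _*_; _^_; _≤_; _<_; s≤s)
  open import Data.Nat.Properties using (*-mono-≤; m^n>0; m^n≢0; *-comm; ≤-pred; *-cancelˡ-≡)
  open import Data.Nat.Divisibility
  open import Data.Nat.Primality using (Prime; prime⇒nonZero)
  open import Data.Empty using (⊥-elim)
  open import Data.List using (List; []; _∷_; map; concatMap; upTo)
  open import Data.List.Membership.Propositional using (_∈_; find; lose)
  open import Data.List.Membership.Propositional.Properties using (∈-map⁻; ∈-map⁺; ∈-concatMap⁻; ∈-concatMap⁺; ∈-upTo⁺; ∈-upTo⁻)
  open import Data.List.Relation.Binary.Permutation.Propositional using (_↭_)
  open import Data.List.Relation.Unary.All as All using (All; _∷_)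
  open import Data.List.Relation.Unary.All.Properties using (All¬⇒¬Any)
  open import Data.List.Relation.Unary.Any using (here; there)
  open import Data.List.Relation.Unary.Unique.Propositional using (Unique; _∷_)
  import Data.List.Relation.Unary.Unique.Propositional.Properties as Unique
  open import Data.Product using (_×_; _,_; proj₁; proj₂; ∃)
  open import Relation.Nullary using (¬_)
  open import Relation.Binary.PropositionalEquality as ≡ using (_≡_; _≢_; refl; sym; trans; cong; subst)
  open import Function using (case_of_)
  open import Algebra.Bundles using (CommutativeMonoid)

  module _ {q : ℕ} (pq : Prime q) {k n : ℕ} (0<n : 0 < n) (q∤n : ¬ (q ∣ n)) where
    private
      instance
        q≢0 : ℕ.NonZero q
        q≢0 = prime⇒nonZero pq
      q^ : ℕ → List ℕ
      q^ i = map (q ^ i *_) (divisorsℕ n)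

      ∈q^⁻ : ∀ {i x} → x ∈ q^ i → ∃ λ d → d ∈ divisorsℕ n × x ≡ q ^ i * d
      ∈q^⁻ {i} = ∈-map⁻ (q ^ i *_)

      q∤divisor : ∀ {d} → d ∈ divisorsℕ n → ¬ (q ∣ d)
      q∤divisor d∈ q∣d = q∤n (∣-trans q∣d (proj₁ (∈-divisorsℕ⁻ {n = n} d∈)))

      ν-on-q^ : ∀ {i x} → x ∈ q^ i → ν q x ≡ i
      ν-on-q^ {i} x∈ with ∈q^⁻ {i} x∈
      ... | d , d∈ , refl = ν-q^a*n pq i d (q∤divisor d∈) (proj₂ (∈-divisorsℕ⁻ {n = n} d∈))

      0<q^k*n : 0 < q ^ k * n
      0<q^k*n = *-mono-≤ (m^n>0 q k) 0<n

      to : ∀ {x} → x ∈ divisorsℕ (q ^ k * n) → x ∈ concatMap q^ (upTo (suc k))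
      to {x} x∈ with ∈-divisorsℕ⁻ {n = q ^ k * n} x∈
      ... | x∣ , 0<x with ν-spec pq x 0<x
      ... | x′ , x≡ , q∤x′ , 0<x′ =
        ∈-concatMap⁺ q^ (lose (∈-upTo⁺ (s≤s i≤k)) (subst (_∈ q^ i) (sym x≡) (∈-map⁺ (q ^ i *_) x′∈)))
        where
        i : ℕ
        i = ν q x
        i≤k : i ≤ k
        i≤k = subst (i ≤_) (ν-q^a*n pq k n q∤n 0<n)
                    (q^k∣⇒k≤ν pq i _ 0<q^k*n (∣-trans (divides x′ (trans x≡ (*-comm (q ^ i) x′))) x∣))
        x′∈ : x′ ∈ divisorsℕ n
        x′∈ = ∈-divisorsℕ⁺ 0<n (∣prime^*⇒∣ pq q∤x′ k (∣-trans (divides (q ^ i) x≡) x∣)) 0<x′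

      from : ∀ {x} → x ∈ concatMap q^ (upTo (suc k)) → x ∈ divisorsℕ (q ^ k * n)
      from x∈ with find (∈-concatMap⁻ q^ {xs = upTo (suc k)} x∈)
      ... | i , i∈ , x∈q^i with ∈q^⁻ {i} x∈q^i
      ... | d , d∈ , refl with ∈-divisorsℕ⁻ {n = n} d∈
      ... | d∣n , 0<d = ∈-divisorsℕ⁺ 0<q^k*n (*-pres-∣ (^-monoʳ-∣ q (≤-pred (∈-upTo⁻ i∈))) d∣n)
                                              (*-mono-≤ (m^n>0 q i) 0<d)

    divisors-q^k*↭ : divisorsℕ (q ^ k * n) ↭ concatMap (λ i → map (q ^ i *_) (divisorsℕ n)) (upTo (suc k))
    divisors-q^k*↭ = unique-∈⇔⇒↭ (unique-divisorsℕ (q ^ k * n)) unique to from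
      where
      unique : Unique (concatMap q^ (upTo (suc k)))
      unique = unique-concatMap q^ (Unique.upTo⁺ (suc k))
                 (λ i → Unique.map⁺ (λ {a} {b} → *-cancelˡ-≡ a b (q ^ i) {{m^n≢0 q i}}) (unique-divisorsℕ n))
                 (λ x∈i x∈j → trans (sym (ν-on-q^ x∈i)) (ν-on-q^ x∈j))

  AllPrimeDivisorsIn : ℕ → List ℕ → Set
  AllPrimeDivisorsIn n L = ∀ p → Prime p → p ∣ n → p ∈ L

  cofactor-prime-divisors : ∀ {q L n n′} k → n ≡ q ^ k * n′ → ¬ (q ∣ n′) →
                            AllPrimeDivisorsIn n (q ∷ L) → AllPrimeDivisorsIn n′ L
  cofactor-prime-divisors {q} k n≡ q∤n′ covers p pp p∣n′ with covers p pp (∣-trans p∣n′ (divides (q ^ k) n≡))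
  ... | here refl = ⊥-elim (q∤n′ p∣n′)
  ... | there p∈L = p∈L

  module _ {c ℓ} (M : CommutativeMonoid c ℓ) where
    open CommutativeMonoid M renaming (refl to ≈-refl; sym to ≈-sym; trans to ≈-trans)
    open ListProduct M
    open import Relation.Binary.Reasoning.Setoid setoid

    ∏-prime-powers : (F : ℕ → Carrier) → F 1 ≈ ε → (∀ a b → F (a * b) ≈ F a ∙ F b) →
                     ∀ {L} → Unique L → All Prime L → ∀ n → 0 < n → AllPrimeDivisorsIn n L →
                     F n ≈ ∏ (λ q → F (q ^ ν q n)) L
    ∏-prime-powers F F1≈ε F-* {[]} _ _ n 0<n covers =
      ≈-trans (reflexive (cong F (no-prime-divisor⇒≡1 n 0<n λ p pp p∣n → case covers p pp p∣n of λ ()))) F1≈ε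
    ∏-prime-powers F F1≈ε F-* {q ∷ L} (q∉L ∷ uniq) (pq ∷ primes) n 0<n covers with ν-spec pq n 0<n
    ... | n′ , n≡ , q∤n′ , 0<n′ = begin
      F n                                   ≈⟨ reflexive (cong F n≡) ⟩
      F (q ^ ν q n * n′)                    ≈⟨ F-* _ _ ⟩
      F (q ^ ν q n) ∙ F n′                  ≈⟨ ∙-congˡ (∏-prime-powers F F1≈ε F-* uniq primes n′ 0<n′
                                                         (cofactor-prime-divisors (ν q n) n≡ q∤n′ covers)) ⟩
      F (q ^ ν q n) ∙ ∏ (λ r → F (r ^ ν r n′)) L
        ≈⟨ ∙-congˡ (∏-cong L λ {r} r∈ → reflexive (cong (λ e → F (r ^ e)) (ν-n′≡ r∈))) ⟩
      F (q ^ ν q n) ∙ ∏ (λ r → F (r ^ ν r n)) L ∎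
      where
      ν-n′≡ : ∀ {r} → r ∈ L → ν r n′ ≡ ν r n
      ν-n′≡ r∈ = sym (trans (cong (ν _) n≡)
                            (ν-prime^* pq (All.lookup primes r∈) (λ { refl → All¬⇒¬Any q∉L r∈ }) (ν q n) n′ 0<n′))

module DivisorSum {c ℓ} (S : CommutativeSemiring c ℓ) where

  open import Defs
  open Primes
  open Valuation
  open Divisors
  open import Data.Nat as ℕ using (ℕ; suc; _^_; _<_; _∸_)
  open import Data.Nat.Divisibility using (∣-trans)
  open import Data.Nat.Primality using (Prime)
  open import Data.List using ([]; _∷_; map; concatMap; upTo)
  open import Data.List.Membership.Propositional using (_∈_)
  open import Data.List.Relation.Unary.All as All using (All; _∷_)
  open import Data.List.Relation.Unary.All.Properties using (All¬⇒¬Any)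
  open import Data.List.Relation.Unary.Unique.Propositional using (Unique; _∷_)
  open import Data.Product using (_,_)
  open import Function using (_∘_; case_of_)
  open import Relation.Binary.PropositionalEquality as ≡ using (_≡_; _≢_; cong; cong₂)

  open CommutativeSemiring S
  open SemiringSum S
  open import Relation.Binary.Reasoning.Setoid setoid

  ∑-divisors-∏ : (φ : ℕ → ℕ → ℕ → Carrier) →
                 ∀ {L} → Unique L → All Prime L → ∀ n → 0 < n → AllPrimeDivisorsIn n L →
                 ∑ (λ d → ∏ (λ q → φ q (ν q d) (ν q n ∸ ν q d)) L) (divisorsℕ n)
                   ≈ ∏ (λ q → ∑ (λ i → φ q i (ν q n ∸ i)) (upTo (suc (ν q n)))) L
  ∑-divisors-∏ φ {[]} _ _ n 0<n covers
    rewrite no-prime-divisor⇒≡1 n 0<n (λ p pp p∣n → case covers p pp p∣n of λ ()) = +-identityʳ 1#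
  ∑-divisors-∏ φ {q ∷ L} (q∉L ∷ uniq) (pq ∷ primes) n 0<n covers with ν-spec pq n 0<n
  ... | n′ , n≡ , q∤n′ , 0<n′ = begin
    ∑ G (divisorsℕ n)
      ≈⟨ reflexive (cong (∑ G ∘ divisorsℕ) n≡) ⟩
    ∑ G (divisorsℕ (q ^ k ℕ.* n′))
      ≈⟨ ∑-↭ G (divisors-q^k*↭ pq {k} 0<n′ q∤n′) ⟩
    ∑ G (concatMap (λ i → map (q ^ i ℕ.*_) (divisorsℕ n′)) (upTo (suc k)))
      ≈⟨ ∑-concatMap G (λ i → map (q ^ i ℕ.*_) (divisorsℕ n′)) (upTo (suc k)) ⟩
    ∑ (λ i → ∑ G (map (q ^ i ℕ.*_) (divisorsℕ n′))) (upTo (suc k))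
      ≈⟨ ∑-cong (upTo (suc k)) (λ {i} _ → trans (∑-map G (q ^ i ℕ.*_) (divisorsℕ n′))
                                                 (∑-cong (divisorsℕ n′) (G-q^i* i))) ⟩
    ∑ (λ i → ∑ (λ d → φ q i (k ∸ i) * H d) (divisorsℕ n′)) (upTo (suc k))
      ≈⟨ ∑-cong (upTo (suc k)) (λ {i} _ → trans (sym (∑-distribˡ (φ q i (k ∸ i)) H (divisorsℕ n′)))
                                                 (*-congˡ (∑-divisors-∏ φ uniq primes n′ 0<n′ covers′))) ⟩
    ∑ (λ i → φ q i (k ∸ i) * ∏ (Local n′) L) (upTo (suc k))
      ≈⟨ sym (∑-distribʳ _ (λ i → φ q i (k ∸ i)) (upTo (suc k))) ⟩
    Local n q * ∏ (Local n′) L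
      ≈⟨ *-congˡ (∏-cong L (λ {r} r∈ → reflexive (cong (λ e → Local′ r e) (ν-n′≡ r∈)))) ⟩
    Local n q * ∏ (Local n) L ∎
    where
    k : ℕ
    k = ν q n
    G H : ℕ → Carrier
    G d = ∏ (λ q → φ q (ν q d) (ν q n ∸ ν q d)) (q ∷ L)
    H d = ∏ (λ r → φ r (ν r d) (ν r n′ ∸ ν r d)) L
    Local′ : ℕ → ℕ → Carrier
    Local′ r e = ∑ (λ i → φ r i (e ∸ i)) (upTo (suc e))
    Local : ℕ → ℕ → Carrier
    Local m r = Local′ r (ν r m)
    covers′ : AllPrimeDivisorsIn n′ L
    covers′ = cofactor-prime-divisors k n≡ q∤n′ covers
    r≢q : ∀ {r} → r ∈ L → r ≢ q
    r≢q r∈ ≡.refl = All¬⇒¬Any q∉L r∈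
    ν-q^i* : ∀ {r} → r ∈ L → ∀ i d → 0 < d → ν r (q ^ i ℕ.* d) ≡ ν r d
    ν-q^i* r∈ = ν-prime^* pq (All.lookup primes r∈) (r≢q r∈)
    ν-n′≡ : ∀ {r} → r ∈ L → ν r n′ ≡ ν r n
    ν-n′≡ r∈ = ≡.sym (≡.trans (cong (ν _) n≡) (ν-q^i* r∈ k n′ 0<n′))
    G-q^i* : ∀ i {d} → d ∈ divisorsℕ n′ → G (q ^ i ℕ.* d) ≈ φ q i (k ∸ i) * H d
    G-q^i* i {d} d∈ with ∈-divisorsℕ⁻ {n = n′} d∈
    ... | d∣n′ , 0<d = *-cong
      (reflexive (cong (λ e → φ q e (k ∸ e)) (ν-q^a*n pq i d (λ q∣d → q∤n′ (∣-trans q∣d d∣n′)) 0<d)))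
      (∏-cong L (λ {r} r∈ → reflexive (cong₂ (λ a b → φ r a (b ∸ a)) (ν-q^i* r∈ i d 0<d) (≡.sym (ν-n′≡ r∈)))))

module Fermat where

  open Primes using (prime⇒≡2+; prime⇒1<p; prime∤1)
  open import Data.Nat as ℕ using (ℕ; zero; suc; _+_; _*_; _^_; _≤_; _<_; _∸_; _!; z≤n; s≤s; _%_; _/_; pred; NonZero)
  open import Data.Nat.Properties
  open import Data.Nat.Combinatorics using (_C_; nCk+nC[k+1]≡[n+1]C[k+1]; nCk≡n!/k![n-k]!; k![n∸k]!∣n!; k>n⇒nCk≡0; nCn≡1)
  open import Data.Nat.Divisibility
  open import Data.Nat.DivMod
  open import Data.Nat.Primality using (Prime; euclidsLemma; prime⇒nonZero)
  open import Data.Nat.Solver using (module +-*-Solver)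
  open import Data.Empty using (⊥-elim)
  open import Data.Product using (_,_; ∃)
  open import Data.Sum using (inj₁; inj₂)
  open import Relation.Nullary using (¬_)
  open import Relation.Binary.PropositionalEquality using (_≡_; refl; sym; trans; cong; cong₂; subst; module ≡-Reasoning)
  open ≡-Reasoning
  open +-*-Solver

  ∑< : ℕ → (ℕ → ℕ) → ℕ
  ∑< zero    f = 0
  ∑< (suc m) f = ∑< m f + f m

  module _ (x : ℕ) where

    binomialSum : ℕ → ℕ → ℕ
    binomialSum n m = ∑< m (λ k → (n C k) * x ^ k)

    binomialSum-suc : ∀ n m → binomialSum (suc n) (suc m) ≡ x * binomialSum n m + binomialSum n (suc m)
    binomialSum-suc n zero    = solve 1 (λ x → con 0 :+ con 1 := x :* con 0 :+ (con 0 :+ con 1)) refl x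
    binomialSum-suc n (suc m) = begin
      binomialSum (suc n) (suc m) + (suc n C suc m) * (x * x ^ m)
        ≡⟨ cong₂ (λ s c → s + c * (x * x ^ m)) (binomialSum-suc n m) (sym (nCk+nC[k+1]≡[n+1]C[k+1] n m)) ⟩
      (x * binomialSum n m + binomialSum n (suc m)) + ((n C m) + (n C suc m)) * (x * x ^ m)
        ≡⟨ solve 6 (λ x a b c d e → (x :* a :+ b) :+ (c :+ d) :* (x :* e) := x :* (a :+ c :* e) :+ (b :+ d :* (x :* e)))
                   refl x (binomialSum n m) (binomialSum n (suc m)) (n C m) (n C suc m) (x ^ m) ⟩
      x * (binomialSum n m + (n C m) * x ^ m) + (binomialSum n (suc m) + (n C suc m) * (x * x ^ m)) ∎

    binomialSum-stable : ∀ n j → binomialSum n (suc n + j) ≡ binomialSum n (suc n)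
    binomialSum-stable n zero    = cong (binomialSum n) (+-identityʳ (suc n))
    binomialSum-stable n (suc j) = begin
      binomialSum n (suc n + suc j)                     ≡⟨ cong (binomialSum n) (+-suc (suc n) j) ⟩
      binomialSum n (suc n + j) + (n C (suc n + j)) * x ^ (suc n + j)
        ≡⟨ cong (λ c → binomialSum n (suc n + j) + c * x ^ (suc n + j)) (k>n⇒nCk≡0 (s≤s (m≤m+n n j))) ⟩
      binomialSum n (suc n + j) + 0                     ≡⟨ +-identityʳ _ ⟩
      binomialSum n (suc n + j)                         ≡⟨ binomialSum-stable n j ⟩
      binomialSum n (suc n)                             ∎

    binomial : ∀ n → (1 + x) ^ n ≡ binomialSum n (suc n)
    binomial zero    = refl
    binomial (suc n) = begin
      (1 + x) * (1 + x) ^ n                         ≡⟨ cong ((1 + x) *_) (binomial n) ⟩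
      (1 + x) * binomialSum n (suc n)               ≡⟨ solve 2 (λ x s → (con 1 :+ x) :* s := x :* s :+ s) refl x _ ⟩
      x * binomialSum n (suc n) + binomialSum n (suc n)
        ≡⟨ cong (x * binomialSum n (suc n) +_) (sym (trans (cong (binomialSum n) (+-comm 1 (suc n))) (binomialSum-stable n 1))) ⟩
      x * binomialSum n (suc n) + binomialSum n (suc (suc n)) ≡⟨ sym (binomialSum-suc n (suc n)) ⟩
      binomialSum (suc n) (suc (suc n))             ∎

  prime∤! : ∀ {p m} → Prime p → m < p → ¬ (p ∣ m !)
  prime∤! {m = zero}  pp _   p∣1 = prime∤1 pp p∣1
  prime∤! {m = suc m} pp m<p p∣ with euclidsLemma (suc m) (m !) pp p∣
  ... | inj₁ p∣1+m = <-irrefl refl (<-≤-trans m<p (∣⇒≤ p∣1+m))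
  ... | inj₂ p∣m!  = prime∤! pp (<-trans (n<1+n m) m<p) p∣m!

  prime∣C : ∀ {p k} → Prime p → 0 < k → k < p → p ∣ p C k
  prime∣C {p} {k} pp 0<k k<p with euclidsLemma (p C k) (k ! * (p ∸ k) !) pp p∣C*k!*[p-k]!
    where
    instance
      k!*[p-k]!≢0 : NonZero (k ! * (p ∸ k) !)
      k!*[p-k]!≢0 = m*n≢0 (k !) ((p ∸ k) !) {{k !≢0}} {{(p ∸ k) !≢0}}
    C*k!*[p-k]!≡p! : (p C k) * (k ! * (p ∸ k) !) ≡ p !
    C*k!*[p-k]!≡p! = trans (cong (_* (k ! * (p ∸ k) !)) (nCk≡n!/k![n-k]! (<⇒≤ k<p))) (m/n*n≡m (k![n∸k]!∣n! (<⇒≤ k<p)))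
    p∣C*k!*[p-k]! : p ∣ (p C k) * (k ! * (p ∸ k) !)
    p∣C*k!*[p-k]! with prime⇒≡2+ pp
    ... | p-2 , refl = subst (p ∣_) (sym C*k!*[p-k]!≡p!) (m∣m*n ((suc p-2) !))
  ... | inj₁ p∣C = p∣C
  ... | inj₂ p∣k!*[p-k]! with euclidsLemma (k !) ((p ∸ k) !) pp p∣k!*[p-k]!
  ...   | inj₁ p∣k!     = ⊥-elim (prime∤! pp k<p p∣k!)
  ...   | inj₂ p∣[p-k]! = ⊥-elim (prime∤! pp (∸-monoʳ-< 0<k (<⇒≤ k<p)) p∣[p-k]!)

  module _ {p} (pp : Prime p) where
    private
      instance
        p≢0 : NonZero p
        p≢0 = prime⇒nonZero pp

    binomialSum≡1-mod-prime : ∀ x m → m < p → ∃ λ c → binomialSum x p (suc m) ≡ 1 + c * p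
    binomialSum≡1-mod-prime x zero    _     = 0 , refl
    binomialSum≡1-mod-prime x (suc m) 1+m<p with binomialSum≡1-mod-prime x m (<-trans (n<1+n m) 1+m<p)
                                              | prime∣C pp (s≤s z≤n) 1+m<p
    ... | c , ≡1+c*p | divides d C≡d*p = c + d * x ^ suc m , (begin
      binomialSum x p (suc m) + (p C suc m) * x ^ suc m ≡⟨ cong₂ (λ s C → s + C * x ^ suc m) ≡1+c*p C≡d*p ⟩
      1 + c * p + d * p * x ^ suc m                   ≡⟨ solve 4 (λ c p d y → con 1 :+ c :* p :+ d :* p :* y
                                                                       := con 1 :+ (c :+ d :* y) :* p)
                                                                 refl c p d (x ^ suc m) ⟩
      1 + (c + d * x ^ suc m) * p                     ∎)

    freshman : ∀ x → ∃ λ c → (1 + x) ^ p ≡ (1 + x ^ p) + c * p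
    freshman x with binomialSum≡1-mod-prime x (pred p) (m≤pred[n]⇒suc[m]≤n ≤-refl)
    ... | c , ≡1+c*p = c , (begin
      (1 + x) ^ p                                    ≡⟨ binomial x p ⟩
      binomialSum x p p + (p C p) * x ^ p            ≡⟨ cong₂ (λ s C → s + C * x ^ p) ≡1+c*p′ (nCn≡1 p) ⟩
      1 + c * p + 1 * x ^ p                          ≡⟨ solve 3 (λ c p y → con 1 :+ c :* p :+ con 1 :* y := (con 1 :+ y) :+ c :* p)
                                                              refl c p (x ^ p) ⟩
      (1 + x ^ p) + c * p                            ∎)
      where
      ≡1+c*p′ : binomialSum x p p ≡ 1 + c * p
      ≡1+c*p′ = trans (cong (binomialSum x p) (sym (suc-pred p))) ≡1+c*p

    fermat : ∀ x → x ^ p % p ≡ x % p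
    fermat zero = cong (λ e → 0 ^ e % p) (sym (suc-pred p))
    fermat (suc x) with freshman x
    ... | c , ≡+c*p = begin
      (1 + x) ^ p % p              ≡⟨ cong (_% p) ≡+c*p ⟩
      ((1 + x ^ p) + c * p) % p    ≡⟨ [m+kn]%n≡m%n (1 + x ^ p) c p ⟩
      (1 + x ^ p) % p              ≡⟨ %-distribˡ-+ 1 (x ^ p) p ⟩
      (1 % p + x ^ p % p) % p      ≡⟨ cong (λ r → (1 % p + r) % p) (fermat x) ⟩
      (1 % p + x % p) % p          ≡⟨ sym (%-distribˡ-+ 1 x p) ⟩
      (1 + x) % p                  ∎

    ∣∸⇒%≡ : ∀ {a b} → b ≤ a → p ∣ a ∸ b → a % p ≡ b % p
    ∣∸⇒%≡ {a} {b} b≤a p∣a-b = trans (cong (_% p) (sym (m+[n∸m]≡n b≤a))) (%-remove-+ʳ b p∣a-b)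

    %≡⇒∣∸ : ∀ {a b} → b ≤ a → a % p ≡ b % p → p ∣ a ∸ b
    %≡⇒∣∸ {a} {b} b≤a a≡b = divides (a / p ∸ b / p) (begin
      a ∸ b                                     ≡⟨ cong₂ _∸_ (m≡m%n+[m/n]*n a p) (m≡m%n+[m/n]*n b p) ⟩
      (a % p + a / p * p) ∸ (b % p + b / p * p) ≡⟨ cong (λ r → (a % p + a / p * p) ∸ (r + b / p * p)) (sym a≡b) ⟩
      (a % p + a / p * p) ∸ (a % p + b / p * p) ≡⟨ [m+n]∸[m+o]≡n∸o (a % p) (a / p * p) (b / p * p) ⟩
      a / p * p ∸ b / p * p                     ≡⟨ sym (*-distribʳ-∸ p (a / p) (b / p)) ⟩
      (a / p ∸ b / p) * p                       ∎)

    private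
      %-cancelˡ-≤ : ∀ y {a b} → ¬ (p ∣ y) → b ≤ a → (y * a) % p ≡ (y * b) % p → a % p ≡ b % p
      %-cancelˡ-≤ y {a} {b} p∤y b≤a ya≡yb
        with euclidsLemma y (a ∸ b) pp (subst (p ∣_) (sym (*-distribˡ-∸ y a b)) (%≡⇒∣∸ (*-monoʳ-≤ y b≤a) ya≡yb))
      ... | inj₁ p∣y   = ⊥-elim (p∤y p∣y)
      ... | inj₂ p∣a-b = ∣∸⇒%≡ b≤a p∣a-b

    %-cancelˡ-prime : ∀ y {a b} → ¬ (p ∣ y) → (y * a) % p ≡ (y * b) % p → a % p ≡ b % p
    %-cancelˡ-prime y {a} {b} p∤y ya≡yb with ≤-total b a
    ... | inj₁ b≤a = %-cancelˡ-≤ y p∤y b≤a ya≡yb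
    ... | inj₂ a≤b = sym (%-cancelˡ-≤ y p∤y a≤b (sym ya≡yb))

    fermat-unit : ∀ y → ¬ (p ∣ y) → y ^ pred p % p ≡ 1
    fermat-unit y p∤y = trans (%-cancelˡ-prime y p∤y y*y^[p-1]≡y*1) (m<n⇒m%n≡m (prime⇒1<p pp))
      where
      y*y^[p-1]≡y*1 : (y * y ^ pred p) % p ≡ (y * 1) % p
      y*y^[p-1]≡y*1 = trans (cong (λ e → y ^ e % p) (suc-pred p)) (trans (fermat y) (cong (_% p) (sym (*-identityʳ y))))

module Residues where

  open import Data.Nat as ℕ using (ℕ; zero; suc; NonZero)
  open import Data.Nat.DivMod using ([m+kn]%n≡m%n; m<n⇒m%n≡m)
  open import Data.Nat.Divisibility using (_∣_; ∣⇒≤; ∣-refl)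
  open import Data.Nat.Properties using (<-irrefl; <-≤-trans)
  open import Data.Integer as ℤ using (ℤ; +_; -[1+_]; +[1+_]; ∣_∣; _%ℕ_; _/ℕ_)
  open import Data.Integer.Properties using (pos-+; pos-*; +-injective)
  open import Data.Integer.DivMod using (a≡a%ℕn+[a/ℕn]*n; n%ℕd<d)
  import Data.Integer.Divisibility.Signed as Signed
  open import Data.Integer.Solver using (module +-*-Solver)
  open import Relation.Binary.PropositionalEquality using (_≡_; refl; cong; cong₂; sym; trans; subst; module ≡-Reasoning)
  open import Data.Empty using (⊥-elim)
  open +-*-Solver

  module _ (q : ℕ) .{{_ : NonZero q}} where

    %ℕ-unique : ∀ x r y → x ≡ + r ℤ.+ y ℤ.* + q → x %ℕ q ≡ r ℕ.% q
    %ℕ-unique x r y x≡r+yq with x %ℕ q | x /ℕ q | a≡a%ℕn+[a/ℕn]*n x q | n%ℕd<d x q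
    ... | s | Q | x≡s+Qq | s<q = go (y ℤ.- Q) r+[y-Q]q≡s
      where
      r+[y-Q]q≡s : + r ℤ.+ (y ℤ.- Q) ℤ.* + q ≡ + s
      r+[y-Q]q≡s = begin
        + r ℤ.+ (y ℤ.- Q) ℤ.* + q
          ≡⟨ solve 4 (λ r y Q q → r :+ (y :- Q) :* q := (r :+ y :* q) :- Q :* q) refl (+ r) y Q (+ q) ⟩
        (+ r ℤ.+ y ℤ.* + q) ℤ.- Q ℤ.* + q ≡⟨ cong (ℤ._- Q ℤ.* + q) (trans (sym x≡r+yq) x≡s+Qq) ⟩
        (+ s ℤ.+ Q ℤ.* + q) ℤ.- Q ℤ.* + q ≡⟨ solve 3 (λ s Q q → (s :+ Q :* q) :- Q :* q := s) refl (+ s) Q (+ q) ⟩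
        + s                               ∎
        where open ≡-Reasoning
      go : ∀ z → + r ℤ.+ z ℤ.* + q ≡ + s → s ≡ r ℕ.% q
      go (+ n) r+nq≡s = trans (sym (m<n⇒m%n≡m s<q)) (trans (cong (ℕ._% q) (sym r+nq≡s′)) ([m+kn]%n≡m%n r n q))
        where
        r+nq≡s′ : r ℕ.+ n ℕ.* q ≡ s
        r+nq≡s′ = +-injective (trans (pos-+ r (n ℕ.* q)) (trans (cong (λ z → + r ℤ.+ z) (pos-* n q)) r+nq≡s))
      go -[1+ n ] r-[1+n]q≡s = trans (sym (m<n⇒m%n≡m s<q)) (sym (trans (cong (ℕ._% q) r≡s+[1+n]q) ([m+kn]%n≡m%n s (suc n) q)))
        where
        r≡s+[1+n]q : r ≡ s ℕ.+ suc n ℕ.* q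
        r≡s+[1+n]q = +-injective (begin
          + r
            ≡⟨ solve 3 (λ r z q → r := (r :+ z :* q) :+ (:- z) :* q) refl (+ r) -[1+ n ] (+ q) ⟩
          (+ r ℤ.+ -[1+ n ] ℤ.* + q) ℤ.+ +[1+ n ] ℤ.* + q ≡⟨ cong (ℤ._+ +[1+ n ] ℤ.* + q) r-[1+n]q≡s ⟩
          + s ℤ.+ +[1+ n ] ℤ.* + q                        ≡⟨ cong (λ z → + s ℤ.+ z) (sym (pos-* (suc n) q)) ⟩
          + s ℤ.+ + (suc n ℕ.* q)                         ≡⟨ sym (pos-+ s (suc n ℕ.* q)) ⟩
          + (s ℕ.+ suc n ℕ.* q)                           ∎)
          where open ≡-Reasoning

    %ℕ-distrib-* : ∀ a b → (a ℤ.* b) %ℕ q ≡ ((a %ℕ q) ℕ.* (b %ℕ q)) ℕ.% q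
    %ℕ-distrib-* a b = %ℕ-unique (a ℤ.* b) (ra ℕ.* rb) (Qa ℤ.* + rb ℤ.+ + ra ℤ.* Qb ℤ.+ Qa ℤ.* Qb ℤ.* + q) (begin
      a ℤ.* b
        ≡⟨ cong₂ ℤ._*_ (a≡a%ℕn+[a/ℕn]*n a q) (a≡a%ℕn+[a/ℕn]*n b q) ⟩
      (+ ra ℤ.+ Qa ℤ.* + q) ℤ.* (+ rb ℤ.+ Qb ℤ.* + q)           ≡⟨ solve 5 (λ x y u v d → (x :+ u :* d) :* (y :+ v :* d)
                                                                             := x :* y :+ (u :* y :+ x :* v :+ u :* v :* d) :* d)
                                                                   refl (+ ra) (+ rb) Qa Qb (+ q) ⟩
      + ra ℤ.* + rb ℤ.+ (Qa ℤ.* + rb ℤ.+ + ra ℤ.* Qb ℤ.+ Qa ℤ.* Qb ℤ.* + q) ℤ.* + q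
        ≡⟨ cong (ℤ._+ (Qa ℤ.* + rb ℤ.+ + ra ℤ.* Qb ℤ.+ Qa ℤ.* Qb ℤ.* + q) ℤ.* + q) (sym (pos-* ra rb)) ⟩
      + (ra ℕ.* rb) ℤ.+ (Qa ℤ.* + rb ℤ.+ + ra ℤ.* Qb ℤ.+ Qa ℤ.* Qb ℤ.* + q) ℤ.* + q ∎)
      where
      open ≡-Reasoning
      ra rb : ℕ
      ra = a %ℕ q
      rb = b %ℕ q
      Qa Qb : ℤ
      Qa = a /ℕ q
      Qb = b /ℕ q

    ∣∣⇒∣%ℕ : ∀ {d} a → d ∣ q → d ∣ ∣ a ∣ → d ∣ a %ℕ q
    ∣∣⇒∣%ℕ {d} a d∣q d∣a =
      Signed.∣⇒∣ᵤ {+ d} {+ (a %ℕ q)}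
        (Signed.∣m+n∣n⇒∣m (subst (Signed._∣_ (+ d)) (a≡a%ℕn+[a/ℕn]*n a q) (Signed.∣ᵤ⇒∣ {+ d} {a} d∣a))
                          (Signed.∣n⇒∣m*n (a /ℕ q) (Signed.∣ᵤ⇒∣ {+ d} {+ q} d∣q)))

    ∣%ℕ⇒∣∣ : ∀ {d} a → d ∣ q → d ∣ a %ℕ q → d ∣ ∣ a ∣
    ∣%ℕ⇒∣∣ {d} a d∣q d∣r =
      Signed.∣⇒∣ᵤ {+ d} {a} (subst (Signed._∣_ (+ d)) (sym (a≡a%ℕn+[a/ℕn]*n a q))
        (Signed.∣m∣n⇒∣m+n (Signed.∣ᵤ⇒∣ {+ d} {+ (a %ℕ q)} d∣r) (Signed.∣n⇒∣m*n (a /ℕ q) (Signed.∣ᵤ⇒∣ {+ d} {+ q} d∣q))))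

    ∣∣⇒%ℕ≡0 : ∀ a → q ∣ ∣ a ∣ → a %ℕ q ≡ 0
    ∣∣⇒%ℕ≡0 a q∣a with a %ℕ q | ∣∣⇒∣%ℕ a ∣-refl q∣a | n%ℕd<d a q
    ... | zero  | _   | _   = refl
    ... | suc r | q∣r | r<q = ⊥-elim (<-irrefl refl (<-≤-trans r<q (∣⇒≤ q∣r)))

module KroneckerPrime where

  open import Defs
  open Primes using (prime⇒≡2+; prime∣prime⇒≡; prime∤1)
  open Fermat using (fermat-unit; %≡⇒∣∸)
  open Residues
  open import Data.Nat as ℕ using (ℕ; zero; suc; _+_; _*_; _^_; _≤_; _<_; _∸_; z≤n; s≤s; _%_; _/_)
  open import Data.Nat.Properties
  open import Data.Nat.Divisibility
  open import Data.Nat.DivMod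
  open import Data.Nat.Primality using (Prime; euclidsLemma; prime[2])
  open import Data.Nat.Solver using (module +-*-Solver)
  open import Data.Fin using (Fin; toℕ; fromℕ<)
  open import Data.Fin.Properties using (all?; toℕ-fromℕ<)
  open import Data.Integer as ℤ using (ℤ; +_; ∣_∣; _%ℕ_)
  import Data.Integer.Properties as ℤ
  open import Data.Integer.DivMod using (n%ℕd<d)
  open import Data.Empty using (⊥-elim)
  open import Function using (_∘_)
  open import Data.Product using (_,_)
  open import Data.Sum using (_⊎_; inj₁; inj₂)
  open import Relation.Nullary using (¬_; yes; no)
  open import Relation.Nullary.Decidable using (toWitness)
  open import Relation.Binary.PropositionalEquality using (_≡_; refl; sym; trans; cong; cong₂; subst; subst₂; module ≡-Reasoning)
  open ≡-Reasoning
  open +-*-Solver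

  χ₈ : ℕ → ℤ
  χ₈ 1 = + 1
  χ₈ 7 = + 1
  χ₈ 3 = ℤ.- (+ 1)
  χ₈ 5 = ℤ.- (+ 1)
  χ₈ _ = + 0

  kronPrime-2 : ∀ a → kronPrime a 2 ≡ χ₈ (a %ℕ 8)
  kronPrime-2 a with a %ℕ 8
  ... | 0 = refl
  ... | 1 = refl
  ... | 2 = refl
  ... | 3 = refl
  ... | 4 = refl
  ... | 5 = refl
  ... | 6 = refl
  ... | 7 = refl
  ... | suc (suc (suc (suc (suc (suc (suc (suc _))))))) = refl

  χ₈-* : ∀ {x y} → x < 8 → y < 8 → χ₈ ((x * y) % 8) ≡ χ₈ x ℤ.* χ₈ y
  χ₈-* {x} {y} x<8 y<8 = subst₂ (λ x y → χ₈ ((x * y) % 8) ≡ χ₈ x ℤ.* χ₈ y) (toℕ-fromℕ< x<8) (toℕ-fromℕ< y<8)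
                                (table (fromℕ< x<8) (fromℕ< y<8))
    where
    table : ∀ (i j : Fin 8) → χ₈ ((toℕ i * toℕ j) % 8) ≡ χ₈ (toℕ i) ℤ.* χ₈ (toℕ j)
    table = toWitness {a? = all? λ i → all? λ j → χ₈ ((toℕ i * toℕ j) % 8) ℤ.≟ χ₈ (toℕ i) ℤ.* χ₈ (toℕ j)} _

  χ₈-even : ∀ r → 2 ∣ r → χ₈ r ≡ + 0
  χ₈-even 1 2∣1 with () ← n∣m⇒m%n≡0 1 2 2∣1
  χ₈-even 3 2∣3 with () ← n∣m⇒m%n≡0 3 2 2∣3
  χ₈-even 5 2∣5 with () ← n∣m⇒m%n≡0 5 2 2∣5
  χ₈-even 7 2∣7 with () ← n∣m⇒m%n≡0 7 2 2∣7
  χ₈-even 0 _ = refl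
  χ₈-even 2 _ = refl
  χ₈-even 4 _ = refl
  χ₈-even 6 _ = refl
  χ₈-even (suc (suc (suc (suc (suc (suc (suc (suc _)))))))) _ = refl

  χ₈²-odd : ∀ r → r < 8 → ¬ (2 ∣ r) → χ₈ r ℤ.* χ₈ r ≡ + 1
  χ₈²-odd 1 _ _ = refl
  χ₈²-odd 3 _ _ = refl
  χ₈²-odd 5 _ _ = refl
  χ₈²-odd 7 _ _ = refl
  χ₈²-odd 0 _ 2∤ = ⊥-elim (2∤ (divides 0 refl))
  χ₈²-odd 2 _ 2∤ = ⊥-elim (2∤ (divides 1 refl))
  χ₈²-odd 4 _ 2∤ = ⊥-elim (2∤ (divides 2 refl))
  χ₈²-odd 6 _ 2∤ = ⊥-elim (2∤ (divides 3 refl))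
  χ₈²-odd (suc (suc (suc (suc (suc (suc (suc (suc _)))))))) (s≤s (s≤s (s≤s (s≤s (s≤s (s≤s (s≤s (s≤s ())))))))) _

  kronPrime-2-* : ∀ a b → kronPrime (a ℤ.* b) 2 ≡ kronPrime a 2 ℤ.* kronPrime b 2
  kronPrime-2-* a b = begin
    kronPrime (a ℤ.* b) 2              ≡⟨ kronPrime-2 (a ℤ.* b) ⟩
    χ₈ ((a ℤ.* b) %ℕ 8)                ≡⟨ cong χ₈ (%ℕ-distrib-* 8 a b) ⟩
    χ₈ (((a %ℕ 8) * (b %ℕ 8)) % 8)     ≡⟨ χ₈-* (n%ℕd<d a 8) (n%ℕd<d b 8) ⟩
    χ₈ (a %ℕ 8) ℤ.* χ₈ (b %ℕ 8)        ≡⟨ sym (cong₂ ℤ._*_ (kronPrime-2 a) (kronPrime-2 b)) ⟩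
    kronPrime a 2 ℤ.* kronPrime b 2    ∎

  kronPrime-2-even : ∀ a → 2 ∣ ∣ a ∣ → kronPrime a 2 ≡ + 0
  kronPrime-2-even a 2∣a = trans (kronPrime-2 a) (χ₈-even (a %ℕ 8) (∣∣⇒∣%ℕ 8 a (divides 4 refl) 2∣a))

  kronPrime-2²-odd : ∀ a → ¬ (2 ∣ ∣ a ∣) → kronPrime a 2 ℤ.* kronPrime a 2 ≡ + 1
  kronPrime-2²-odd a 2∤a = trans (cong₂ ℤ._*_ (kronPrime-2 a) (kronPrime-2 a))
                                 (χ₈²-odd (a %ℕ 8) (n%ℕd<d a 8) (2∤a ∘ ∣%ℕ⇒∣∣ 8 a (divides 4 refl)))

  ^-distribʳ-* : ∀ x y k → (x * y) ^ k ≡ x ^ k * y ^ k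
  ^-distribʳ-* x y zero    = refl
  ^-distribʳ-* x y (suc k) = trans (cong ((x * y) *_) (^-distribʳ-* x y k))
    (solve 4 (λ x y a b → (x :* y) :* (a :* b) := (x :* a) :* (y :* b)) refl x y (x ^ k) (y ^ k))

  %-^ : ∀ x j q .{{_ : ℕ.NonZero q}} → ((x % q) ^ j) % q ≡ (x ^ j) % q
  %-^ x zero    q = refl
  %-^ x (suc j) q = begin
    ((x % q) * (x % q) ^ j) % q            ≡⟨ %-distribˡ-* (x % q) ((x % q) ^ j) q ⟩
    ((x % q % q) * ((x % q) ^ j % q)) % q  ≡⟨ cong₂ (λ u v → (u * v) % q) (m%n%n≡m%n x q) (%-^ x j q) ⟩
    ((x % q) * (x ^ j % q)) % q            ≡⟨ sym (%-distribˡ-* x (x ^ j) q) ⟩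
    (x * x ^ j) % q                        ∎

  eulerSign : ℕ → ℤ
  eulerSign zero          = + 0
  eulerSign (suc zero)    = + 1
  eulerSign (suc (suc _)) = ℤ.- (+ 1)

  -- Euler's criterion is built into the definition of legendre, so its multiplicativity comes down
  -- to Fermat's little theorem.
  module OddPrime (t : ℕ) (pq : Prime (3 + t)) where
    q k : ℕ
    q = 3 + t
    k = divℕ (q ∸ 1) 2

    euler : ℤ → ℕ
    euler a = ((a %ℕ q) ^ k) % q

    kronPrime-euler : ∀ a → kronPrime a q ≡ eulerSign (euler a)
    kronPrime-euler a with euler a
    ... | zero        = refl
    ... | suc zero    = refl
    ... | suc (suc _) = refl

    euler-* : ∀ a b → euler (a ℤ.* b) ≡ (euler a * euler b) % q
    euler-* a b = begin
      (((a ℤ.* b) %ℕ q) ^ k) % q                 ≡⟨ cong (λ r → (r ^ k) % q) (%ℕ-distrib-* q a b) ⟩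
      ((((a %ℕ q) * (b %ℕ q)) % q) ^ k) % q      ≡⟨ %-^ ((a %ℕ q) * (b %ℕ q)) k q ⟩
      (((a %ℕ q) * (b %ℕ q)) ^ k) % q            ≡⟨ cong (_% q) (^-distribʳ-* (a %ℕ q) (b %ℕ q) k) ⟩
      ((a %ℕ q) ^ k * (b %ℕ q) ^ k) % q          ≡⟨ %-distribˡ-* ((a %ℕ q) ^ k) ((b %ℕ q) ^ k) q ⟩
      (euler a * euler b) % q                    ∎

    euler-≡0 : ∀ a → q ∣ ∣ a ∣ → euler a ≡ 0
    euler-≡0 a q∣a = begin
      ((a %ℕ q) ^ k) % q    ≡⟨ cong (λ r → (r ^ k) % q) (∣∣⇒%ℕ≡0 q a q∣a) ⟩
      (0 ^ k) % q           ≡⟨ cong (λ e → (0 ^ e) % q) (m/n≡1+[m∸n]/n {m = 2 + t} {n = 2} (s≤s (s≤s z≤n))) ⟩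
      0                     ∎

    k+k≡q-1 : k + k ≡ q ∸ 1
    k+k≡q-1 with q % 2 | m≡m%n+[m/n]*n q 2 | m%n<n q 2 | m%n≡0⇒n∣m q 2
    ... | 0           | _      | _                 | 2∣q = ⊥-elim (2∤q (2∣q refl))
      where
      2∤q : ¬ (2 ∣ q)
      2∤q 2∣q with () ← prime∣prime⇒≡ pq prime[2] 2∣q
    ... | suc (suc _) | _      | s≤s (s≤s ())      | _
    ... | 1           | q≡1+2k | _                 | _ = begin
      k + k                 ≡⟨ solve 1 (λ x → x :+ x := x :* con 2) refl k ⟩
      k * 2                 ≡⟨ cong (λ m → m / 2 * 2) q-1≡ ⟩
      (q / 2 * 2) / 2 * 2   ≡⟨ cong (_* 2) (m*n/n≡m (q / 2) 2) ⟩
      q / 2 * 2             ≡⟨ sym q-1≡ ⟩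
      q ∸ 1                 ∎
      where
      q-1≡ : q ∸ 1 ≡ q / 2 * 2
      q-1≡ = cong (_∸ 1) q≡1+2k

    euler²≡1 : ∀ a → ¬ (q ∣ ∣ a ∣) → (euler a * euler a) % q ≡ 1
    euler²≡1 a q∤a = begin
      (euler a * euler a) % q    ≡⟨ sym (%-distribˡ-* (y ^ k) (y ^ k) q) ⟩
      (y ^ k * y ^ k) % q        ≡⟨ cong (_% q) (sym (^-distribˡ-+-* y k k)) ⟩
      (y ^ (k + k)) % q          ≡⟨ cong (λ e → (y ^ e) % q) k+k≡q-1 ⟩
      (y ^ (q ∸ 1)) % q          ≡⟨ fermat-unit pq y (q∤a ∘ ∣%ℕ⇒∣∣ q a ∣-refl) ⟩
      1                          ∎
      where
      y : ℕ
      y = a %ℕ q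

    √1 : ∀ r → r < q → (r * r) % q ≡ 1 → r ≡ 1 ⊎ r ≡ q ∸ 1
    √1 zero      _   ()
    √1 (suc r-1) r<q r²≡1 with euclidsLemma r-1 (r-1 + 2) pq q∣[r-1][r+1]
      where
      q∣[r-1][r+1] : q ∣ r-1 * (r-1 + 2)
      q∣[r-1][r+1] = subst (q ∣_) (solve 1 (λ x → x :+ x :* (con 1 :+ x) := x :* (x :+ con 2)) refl r-1)
                           (%≡⇒∣∸ pq (s≤s z≤n) r²≡1)
    ... | inj₁ q∣r-1 = inj₁ (cong suc (q∣x<q⇒≡0 q∣r-1 (<-trans (n<1+n r-1) r<q)))
      where
      q∣x<q⇒≡0 : ∀ {x} → q ∣ x → x < q → x ≡ 0
      q∣x<q⇒≡0 {zero}  _   _   = refl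
      q∣x<q⇒≡0 {suc x} q∣x x<q = ⊥-elim (<-irrefl refl (<-≤-trans x<q (∣⇒≤ q∣x)))
    ... | inj₂ q∣r+3 = inj₂ (trans (sym (m+n∸n≡m (suc r-1) 1)) (cong (_∸ 1) r+1≡q))
      where
      r+1≡q : suc r-1 + 1 ≡ q
      r+1≡q = ≤-antisym (subst (_≤ q) (+-comm 1 (suc r-1)) r<q)
                        (∣⇒≤ (subst (q ∣_) (solve 1 (λ x → x :+ con 2 := (con 1 :+ x) :+ con 1) refl r-1) q∣r+3))

    eulerSign-* : ∀ {x y} → x ≡ 1 ⊎ x ≡ q ∸ 1 → y ≡ 1 ⊎ y ≡ q ∸ 1 →
                  eulerSign ((x * y) % q) ≡ eulerSign x ℤ.* eulerSign y
    eulerSign-* (inj₁ refl) (inj₁ refl) = refl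
    eulerSign-* (inj₁ refl) (inj₂ refl) = cong eulerSign (trans (cong (_% q) (*-identityˡ (q ∸ 1))) (m<n⇒m%n≡m {n = q} (≤-refl {q})))
    eulerSign-* (inj₂ refl) (inj₁ refl) = cong eulerSign (trans (cong (_% q) (*-identityʳ (q ∸ 1))) (m<n⇒m%n≡m {n = q} (≤-refl {q})))
    eulerSign-* (inj₂ refl) (inj₂ refl) = cong eulerSign (trans (cong (_% q) [q-1]²≡1+[q-2]q) ([m+kn]%n≡m%n 1 (1 + t) q))
      where
      [q-1]²≡1+[q-2]q : (2 + t) * (2 + t) ≡ 1 + (1 + t) * q
      [q-1]²≡1+[q-2]q = solve 1 (λ t → (con 2 :+ t) :* (con 2 :+ t) := con 1 :+ (con 1 :+ t) :* (con 3 :+ t)) refl t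

    euler-unit : ∀ a → ¬ (q ∣ ∣ a ∣) → euler a ≡ 1 ⊎ euler a ≡ q ∸ 1
    euler-unit a q∤a = √1 (euler a) (m%n<n ((a %ℕ q) ^ k) q) (euler²≡1 a q∤a)

    kronPrime-odd-≡0 : ∀ a → q ∣ ∣ a ∣ → kronPrime a q ≡ + 0
    kronPrime-odd-≡0 a q∣a = trans (kronPrime-euler a) (cong eulerSign (euler-≡0 a q∣a))

    kronPrime-odd-* : ∀ a b → kronPrime (a ℤ.* b) q ≡ kronPrime a q ℤ.* kronPrime b q
    kronPrime-odd-* a b with q ∣? ∣ a ∣ | q ∣? ∣ b ∣
    ... | yes q∣a | _ = begin
      kronPrime (a ℤ.* b) q
        ≡⟨ kronPrime-odd-≡0 (a ℤ.* b) (subst (q ∣_) (sym (ℤ.abs-* a b)) (∣m⇒∣m*n ∣ b ∣ q∣a)) ⟩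
      + 0                                ≡⟨ sym (ℤ.*-zeroˡ (kronPrime b q)) ⟩
      + 0 ℤ.* kronPrime b q              ≡⟨ cong (ℤ._* kronPrime b q) (sym (kronPrime-odd-≡0 a q∣a)) ⟩
      kronPrime a q ℤ.* kronPrime b q    ∎
    ... | no _ | yes q∣b = begin
      kronPrime (a ℤ.* b) q
        ≡⟨ kronPrime-odd-≡0 (a ℤ.* b) (subst (q ∣_) (sym (ℤ.abs-* a b)) (∣n⇒∣m*n ∣ a ∣ q∣b)) ⟩
      + 0                                ≡⟨ sym (ℤ.*-zeroʳ (kronPrime a q)) ⟩
      kronPrime a q ℤ.* + 0              ≡⟨ cong (kronPrime a q ℤ.*_) (sym (kronPrime-odd-≡0 b q∣b)) ⟩
      kronPrime a q ℤ.* kronPrime b q    ∎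
    ... | no q∤a | no q∤b = begin
      kronPrime (a ℤ.* b) q                  ≡⟨ kronPrime-euler (a ℤ.* b) ⟩
      eulerSign (euler (a ℤ.* b))            ≡⟨ cong eulerSign (euler-* a b) ⟩
      eulerSign ((euler a * euler b) % q)    ≡⟨ eulerSign-* (euler-unit a q∤a) (euler-unit b q∤b) ⟩
      eulerSign (euler a) ℤ.* eulerSign (euler b) ≡⟨ sym (cong₂ ℤ._*_ (kronPrime-euler a) (kronPrime-euler b)) ⟩
      kronPrime a q ℤ.* kronPrime b q        ∎

    kronPrime-odd² : ∀ a → ¬ (q ∣ ∣ a ∣) → kronPrime a q ℤ.* kronPrime a q ≡ + 1
    kronPrime-odd² a q∤a = trans (cong₂ ℤ._*_ (kronPrime-euler a) (kronPrime-euler a)) (sq (euler-unit a q∤a))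
      where
      sq : ∀ {x} → x ≡ 1 ⊎ x ≡ q ∸ 1 → eulerSign x ℤ.* eulerSign x ≡ + 1
      sq (inj₁ refl) = refl
      sq (inj₂ refl) = refl

  module _ {q} (pq : Prime q) where

    kronPrime-* : ∀ a b → kronPrime (a ℤ.* b) q ≡ kronPrime a q ℤ.* kronPrime b q
    kronPrime-* with prime⇒≡2+ pq
    ... | zero  , refl = kronPrime-2-*
    ... | suc t , refl = OddPrime.kronPrime-odd-* t pq

    kronPrime-≡0 : ∀ a → q ∣ ∣ a ∣ → kronPrime a q ≡ + 0
    kronPrime-≡0 with prime⇒≡2+ pq
    ... | zero  , refl = kronPrime-2-even
    ... | suc t , refl = OddPrime.kronPrime-odd-≡0 t pq

    kronPrime² : ∀ a → ¬ (q ∣ ∣ a ∣) → kronPrime a q ℤ.* kronPrime a q ≡ + 1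
    kronPrime² with prime⇒≡2+ pq
    ... | zero  , refl = kronPrime-2²-odd
    ... | suc t , refl = OddPrime.kronPrime-odd² t pq

    -- χ ≡ χ * χ and χ * χ ≡ 1 force χ ≡ 1.
    kronPrime-1 : kronPrime (+ 1) q ≡ + 1
    kronPrime-1 = trans (kronPrime-* (+ 1) (+ 1)) (kronPrime² (+ 1) (prime∤1 pq))

module Kronecker where

  open import Defs
  open Primes
  open Valuation
  open KroneckerPrime
  open import Data.Nat as ℕ using (ℕ; zero; suc; _*_; _≤_; _<_; z≤n; s≤s)
  open import Data.Nat.Properties using (≤-refl; ≤-reflexive; <-irrefl; <-≤-trans; m≤m*n; m≤n*m; ≤∧≢⇒<; ≤-pred)
  open import Data.Nat.Divisibility using (_∣_; ∣⇒≤)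
  open import Data.Nat.Primality using (Prime; prime?)
  open import Data.Integer as ℤ using (ℤ; +_; -[1+_]; +[1+_]; ∣_∣)
  import Data.Integer.Properties as ℤ

  open import Data.List using ([]; _∷_; _++_)
  open import Data.List.Properties using (applyUpTo-∷ʳ)
  open import Data.List.Membership.Propositional using (_∈_)
  open import Data.Bool using (if_then_else_)
  open import Data.Empty using (⊥-elim)
  open import Function using (_∘_)
  open import Data.Product using (proj₁)
  open import Data.Sum using (inj₁; inj₂)
  open import Relation.Nullary using (¬_; yes; no; does)
  open import Relation.Binary.PropositionalEquality using (_≡_; _≢_; refl; sym; trans; cong; cong₂; module ≡-Reasoning)
  open ≡-Reasoning
  open import Algebra.Properties.CommutativeSemigroup ℤ.*-commutativeSemigroup using (interchange)
  open ListProduct ℤ.*-1-commutativeMonoid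

  kronProd : ℤ → ℕ → ℕ → ℤ
  kronProd a x K = ∏ (λ p → kronPrime a p ℤ.^ ν p x) (primesUpTo K)

  kronProd-suc : ∀ a x K → 0 < x → x ≤ K → kronProd a x (suc K) ≡ kronProd a x K
  kronProd-suc a x K 0<x x≤K = begin
    kronProd a x (suc K)                       ≡⟨ ∏-filter prime? f (range1 (suc K)) ⟩
    ∏ g (range1 (suc K))                       ≡⟨ cong (∏ g) (sym (applyUpTo-∷ʳ suc K)) ⟩
    ∏ g (range1 K ++ suc K ∷ [])               ≡⟨ ∏-++ g (range1 K) (suc K ∷ []) ⟩
    ∏ g (range1 K) ℤ.* (g (suc K) ℤ.* + 1)     ≡⟨ cong (λ z → ∏ g (range1 K) ℤ.* (z ℤ.* + 1)) g[1+K]≡1 ⟩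
    ∏ g (range1 K) ℤ.* + 1                     ≡⟨ ℤ.*-identityʳ _ ⟩
    ∏ g (range1 K)                             ≡⟨ sym (∏-filter prime? f (range1 K)) ⟩
    kronProd a x K                             ∎
    where
    f g : ℕ → ℤ
    f p = kronPrime a p ℤ.^ ν p x
    g p = if does (prime? p) then f p else + 1
    g[1+K]≡1 : g (suc K) ≡ + 1
    g[1+K]≡1 with prime? (suc K)
    ... | no _    = refl
    ... | yes p-prime = cong (kronPrime a (suc K) ℤ.^_) (ν≡0 p-prime x 1+K∤x 0<x)
      where
      1+K∤x : ¬ (suc K ∣ x)
      1+K∤x 1+K∣x = <-irrefl refl (<-≤-trans (s≤s x≤K) (∣⇒≤ {{ℕ.>-nonZero 0<x}} 1+K∣x))

  kronProd-extend : ∀ a x K → 0 < x → x ≤ K → kronProd a x K ≡ kronProd a x x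
  kronProd-extend a x K 0<x x≤K with x ℕ.≟ K
  ... | yes refl = refl
  kronProd-extend a x zero    0<x x≤0 | no _ = ⊥-elim (<-irrefl refl (<-≤-trans 0<x x≤0))
  kronProd-extend a x (suc K) 0<x x≤K | no x≢K =
    trans (kronProd-suc a x K 0<x x≤K′) (kronProd-extend a x K 0<x x≤K′)
    where
    x≤K′ : x ≤ K
    x≤K′ = ≤-pred (≤∧≢⇒< x≤K x≢K)

  kronecker-kronProd : ∀ a n → n ≢ + 0 → ∀ K → ∣ n ∣ ≤ K → kronecker a n ≡ kronSign a n ℤ.* kronProd a ∣ n ∣ K
  kronecker-kronProd a (+ zero)   n≢0 = ⊥-elim (n≢0 refl)
  kronecker-kronProd a +[1+ n ]  _   K n≤K = cong (kronSign a +[1+ n ] ℤ.*_) (sym (kronProd-extend a (suc n) K (s≤s z≤n) n≤K))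
  kronecker-kronProd a -[1+ n ]  _   K n≤K = cong (kronSign a -[1+ n ] ℤ.*_) (sym (kronProd-extend a (suc n) K (s≤s z≤n) n≤K))

  kronSign-+ : ∀ a x → kronSign a (+ x) ≡ + 1
  kronSign-+ (+ _)    _ = refl
  kronSign-+ -[1+ _ ] _ = refl

  kronSign-*ˡ : ∀ a b n → a ≢ + 0 → b ≢ + 0 → kronSign (a ℤ.* b) n ≡ kronSign a n ℤ.* kronSign b n
  kronSign-*ˡ (+ zero)  _         _         a≢0 _   = ⊥-elim (a≢0 refl)
  kronSign-*ˡ _         (+ zero)  _         _   b≢0 = ⊥-elim (b≢0 refl)
  kronSign-*ˡ +[1+ _ ]  +[1+ _ ]  (+ _)     _   _   = refl
  kronSign-*ˡ +[1+ _ ]  +[1+ _ ]  -[1+ _ ]  _   _   = refl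
  kronSign-*ˡ +[1+ _ ]  -[1+ _ ]  (+ _)     _   _   = refl
  kronSign-*ˡ +[1+ _ ]  -[1+ _ ]  -[1+ _ ]  _   _   = refl
  kronSign-*ˡ -[1+ _ ]  +[1+ _ ]  (+ _)     _   _   = refl
  kronSign-*ˡ -[1+ _ ]  +[1+ _ ]  -[1+ _ ]  _   _   = refl
  kronSign-*ˡ -[1+ _ ]  -[1+ _ ]  (+ _)     _   _   = refl
  kronSign-*ˡ -[1+ _ ]  -[1+ _ ]  -[1+ _ ]  _   _   = refl

  kronSign-*ʳ : ∀ a x y → x ≢ + 0 → y ≢ + 0 → kronSign a (x ℤ.* y) ≡ kronSign a x ℤ.* kronSign a y
  kronSign-*ʳ _         (+ zero)  _         x≢0 _   = ⊥-elim (x≢0 refl)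
  kronSign-*ʳ _         _         (+ zero)  _   y≢0 = ⊥-elim (y≢0 refl)
  kronSign-*ʳ (+ _)     +[1+ _ ]  +[1+ _ ]  _   _   = refl
  kronSign-*ʳ (+ _)     +[1+ _ ]  -[1+ _ ]  _   _   = refl
  kronSign-*ʳ (+ _)     -[1+ _ ]  +[1+ _ ]  _   _   = refl
  kronSign-*ʳ (+ _)     -[1+ _ ]  -[1+ _ ]  _   _   = refl
  kronSign-*ʳ -[1+ _ ]  +[1+ _ ]  +[1+ _ ]  _   _   = refl
  kronSign-*ʳ -[1+ _ ]  +[1+ _ ]  -[1+ _ ]  _   _   = refl
  kronSign-*ʳ -[1+ _ ]  -[1+ _ ]  +[1+ _ ]  _   _   = refl
  kronSign-*ʳ -[1+ _ ]  -[1+ _ ]  -[1+ _ ]  _   _   = refl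

  ^-distribʳ-*ℤ : ∀ u v k → (u ℤ.* v) ℤ.^ k ≡ u ℤ.^ k ℤ.* v ℤ.^ k
  ^-distribʳ-*ℤ u v zero    = refl
  ^-distribʳ-*ℤ u v (suc k) = trans (cong ((u ℤ.* v) ℤ.*_) (^-distribʳ-*ℤ u v k)) (interchange u v (u ℤ.^ k) (v ℤ.^ k))

  kronProd-*ˡ : ∀ a b x K → kronProd (a ℤ.* b) x K ≡ kronProd a x K ℤ.* kronProd b x K
  kronProd-*ˡ a b x K = trans
    (∏-cong (primesUpTo K) λ {p} p∈ → trans (cong (ℤ._^ ν p x) (kronPrime-* (proj₁ (∈-primesUpTo⁻ {n = K} p∈)) a b))
                                           (^-distribʳ-*ℤ (kronPrime a p) (kronPrime b p) (ν p x)))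
    (∏-∙ (λ p → kronPrime a p ℤ.^ ν p x) (λ p → kronPrime b p ℤ.^ ν p x) (primesUpTo K))

  kronProd-*ʳ : ∀ a x y K → 0 < x → 0 < y → kronProd a (x * y) K ≡ kronProd a x K ℤ.* kronProd a y K
  kronProd-*ʳ a x y K 0<x 0<y = trans
    (∏-cong (primesUpTo K) λ {p} p∈ → trans (cong (kronPrime a p ℤ.^_) (ν-* (proj₁ (∈-primesUpTo⁻ {n = K} p∈)) x y 0<x 0<y))
                                           (ℤ.^-distribˡ-+-* (kronPrime a p) (ν p x) (ν p y)))
    (∏-∙ (λ p → kronPrime a p ℤ.^ ν p x) (λ p → kronPrime a p ℤ.^ ν p y) (primesUpTo K))

  ∣∣-pos : ∀ n → n ≢ + 0 → 0 < ∣ n ∣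
  ∣∣-pos (+ zero)  n≢0 = ⊥-elim (n≢0 refl)
  ∣∣-pos +[1+ _ ] _    = s≤s z≤n
  ∣∣-pos -[1+ _ ] _    = s≤s z≤n

  *-≢0 : ∀ x y → x ≢ + 0 → y ≢ + 0 → x ℤ.* y ≢ + 0
  *-≢0 x y x≢0 y≢0 xy≡0 with ℤ.i*j≡0⇒i≡0∨j≡0 x xy≡0
  ... | inj₁ x≡0 = x≢0 x≡0
  ... | inj₂ y≡0 = y≢0 y≡0

  kronecker-*ˡ : ∀ a b n → a ≢ + 0 → b ≢ + 0 → n ≢ + 0 → kronecker (a ℤ.* b) n ≡ kronecker a n ℤ.* kronecker b n
  kronecker-*ˡ a b n a≢0 b≢0 n≢0 = begin
    kronecker (a ℤ.* b) n                                     ≡⟨ kronecker-kronProd (a ℤ.* b) n n≢0 k ≤-refl ⟩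
    kronSign (a ℤ.* b) n ℤ.* kronProd (a ℤ.* b) k k   ≡⟨ cong₂ ℤ._*_ (kronSign-*ˡ a b n a≢0 b≢0) (kronProd-*ˡ a b k k) ⟩
    (kronSign a n ℤ.* kronSign b n) ℤ.* (kronProd a k k ℤ.* kronProd b k k)
                                                              ≡⟨ interchange (kronSign a n) (kronSign b n) (kronProd a k k) (kronProd b k k) ⟩
    (kronSign a n ℤ.* kronProd a k k) ℤ.* (kronSign b n ℤ.* kronProd b k k)
                                                              ≡⟨ sym (cong₂ ℤ._*_ (kronecker-kronProd a n n≢0 k ≤-refl)
                                                                                   (kronecker-kronProd b n n≢0 k ≤-refl)) ⟩
    kronecker a n ℤ.* kronecker b n                           ∎
    where
    k : ℕ
    k = ∣ n ∣

  kronecker-*ʳ : ∀ a x y → x ≢ + 0 → y ≢ + 0 → kronecker a (x ℤ.* y) ≡ kronecker a x ℤ.* kronecker a y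
  kronecker-*ʳ a x y x≢0 y≢0 = begin
    kronecker a (x ℤ.* y)
      ≡⟨ kronecker-kronProd a (x ℤ.* y) (*-≢0 x y x≢0 y≢0) K (≤-reflexive (ℤ.abs-* x y)) ⟩
    kronSign a (x ℤ.* y) ℤ.* kronProd a (∣ x ℤ.* y ∣) K
      ≡⟨ cong₂ ℤ._*_ (kronSign-*ʳ a x y x≢0 y≢0)
                     (trans (cong (λ z → kronProd a z K) (ℤ.abs-* x y)) (kronProd-*ʳ a ∣ x ∣ ∣ y ∣ K 0<x 0<y)) ⟩
    (kronSign a x ℤ.* kronSign a y) ℤ.* (kronProd a (∣ x ∣) K ℤ.* kronProd a (∣ y ∣) K)
      ≡⟨ interchange (kronSign a x) (kronSign a y) (kronProd a (∣ x ∣) K) (kronProd a (∣ y ∣) K) ⟩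
    (kronSign a x ℤ.* kronProd a (∣ x ∣) K) ℤ.* (kronSign a y ℤ.* kronProd a (∣ y ∣) K)
      ≡⟨ sym (cong₂ ℤ._*_ (kronecker-kronProd a x x≢0 K (m≤m*n ∣ x ∣ ∣ y ∣ {{ℕ.>-nonZero 0<y}}))
                          (kronecker-kronProd a y y≢0 K (m≤n*m ∣ y ∣ ∣ x ∣ {{ℕ.>-nonZero 0<x}}))) ⟩
    kronecker a x ℤ.* kronecker a y
      ∎
    where
    K : ℕ
    K = ∣ x ∣ * ∣ y ∣
    0<x : 0 < ∣ x ∣
    0<x = ∣∣-pos x x≢0
    0<y : 0 < ∣ y ∣
    0<y = ∣∣-pos y y≢0

  kronecker-+ : ∀ a x K → 0 < x → x ≤ K → kronecker a (+ x) ≡ kronProd a x K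
  kronecker-+ a (suc x) K _ x≤K =
    trans (kronecker-kronProd a (+ suc x) (λ ()) K x≤K) (trans (cong (ℤ._* kronProd a (suc x) K) (kronSign-+ a (suc x))) (ℤ.*-identityˡ _))

  kronecker-prime : ∀ a {q} → Prime q → kronecker a (+ q) ≡ kronPrime a q
  kronecker-prime a {q} pq = begin
    kronecker a (+ q)            ≡⟨ kronecker-+ a q q (prime⇒pos pq) ≤-refl ⟩
    kronProd a q q               ≡⟨ ∏-support-single (λ p → kronPrime a p ℤ.^ ν p q) (unique-primesUpTo q) (∈-primesUpTo⁺ pq ≤-refl)
                                      (λ {p} p∈ p≢q → cong (kronPrime a p ℤ.^_)
                                         (ν≡0 (pp p∈) q (p≢q ∘ prime∣prime⇒≡ pq (pp p∈)) (prime⇒pos pq))) ⟩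
    kronPrime a q ℤ.^ ν q q      ≡⟨ cong (kronPrime a q ℤ.^_) (ν-q pq) ⟩
    kronPrime a q ℤ.^ 1          ≡⟨ ℤ.^-identityʳ _ ⟩
    kronPrime a q                ∎
    where

    pp : ∀ {p} → p ∈ primesUpTo q → Prime p
    pp p∈ = proj₁ (∈-primesUpTo⁻ {n = q} p∈)

module Discriminant where

  open import Defs
  open Primes
  open Valuation
  open Residues using (%ℕ-distrib-*)
  open KroneckerPrime using (kronPrime-1; kronPrime-≡0)
  open Kronecker
  open Divisors using (∏-prime-powers)
  open import Data.Nat as ℕ using (ℕ; zero; suc; _+_; _*_; _^_; _≤_; _<_; z≤n; s≤s; _%_)
  open import Data.Nat.Properties
  open import Data.Nat.Divisibility
  open import Data.Nat.DivMod using (m∣n⇒o%n%m≡o%m; m%n<n; m≡m%n+[m/n]*n)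
  open import Data.Nat.ListAction using (product)
  open import Data.Nat.ListAction.Properties using (∈⇒∣product)
  open import Data.Nat.Primality using (Prime; productOfPrimes≢0)
  open import Data.Integer as ℤ using (ℤ; +_; -[1+_]; ∣_∣; _%ℕ_)
  import Data.Integer.Properties as ℤ
  open import Data.Bool using (true; false)
  open import Data.Empty using (⊥-elim)
  open import Data.List using ([]; _∷_; map)
  open import Data.List.Properties using (map-id)
  open import Data.List.Membership.Propositional using (_∈_)
  open import Data.List.Relation.Unary.All as All using (All; []; _∷_)
  open import Data.Product using (proj₁; proj₂)
  open import Relation.Nullary using (¬_; does)
  open import Relation.Binary.PropositionalEquality using (_≡_; _≢_; refl; sym; trans; cong; cong₂; subst; module ≡-Reasoning)
  open ≡-Reasoning

  ∣Dp∣ : ∀ p → ∣ Dp p ∣ ≡ p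
  ∣Dp∣ p with does (p % 4 ℕ.≟ 1)
  ... | true  = refl
  ... | false = ℤ.∣-i∣≡∣i∣ (+ p)

  ∣discOf∣ : ∀ S → ∣ discOf S ∣ ≡ product S
  ∣discOf∣ []      = refl
  ∣discOf∣ (p ∷ S) = trans (ℤ.abs-* (Dp p) (discOf S)) (cong₂ _*_ (∣Dp∣ p) (∣discOf∣ S))

  Dp≢0 : ∀ {p} → Prime p → Dp p ≢ + 0
  Dp≢0 {p} pp Dp≡0 = <-irrefl (sym (trans (sym (∣Dp∣ p)) (cong ∣_∣ Dp≡0))) (prime⇒pos pp)

  discOf≢0 : ∀ {S} → All Prime S → discOf S ≢ + 0
  discOf≢0 {S} primes discOf≡0 =
    ℕ.≢-nonZero⁻¹ (product S) {{productOfPrimes≢0 primes}} (trans (sym (∣discOf∣ S)) (cong ∣_∣ discOf≡0))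

  kronPrime-discOf-∈ : ∀ {q S} → Prime q → q ∈ S → kronPrime (discOf S) q ≡ + 0
  kronPrime-discOf-∈ {q} {S} pq q∈S = kronPrime-≡0 pq (discOf S) (subst (q ∣_) (sym (∣discOf∣ S)) (∈⇒∣product q∈S))

  Dp≡1-mod-4 : ∀ {p} → ¬ (2 ∣ p) → Dp p %ℕ 4 ≡ 1
  Dp≡1-mod-4 {zero}  2∤0 = ⊥-elim (2∤0 (divides 0 refl))
  Dp≡1-mod-4 {suc p} 2∤p with suc p % 4 in p%4≡ | m%n<n (suc p) 4 | m≡m%n+[m/n]*n (suc p) 4
  ... | 0 | _ | p≡4k   = ⊥-elim (2∤p (divides (suc p ℕ./ 4 * 2) (trans p≡4k (sym (*-assoc (suc p ℕ./ 4) 2 2)))))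
  ... | 1 | _ | _      = p%4≡
  ... | 2 | _ | p≡2+4k = ⊥-elim (2∤p (divides (1 + suc p ℕ./ 4 * 2) (trans p≡2+4k (2+4k≡[1+2k]*2 (suc p ℕ./ 4)))))
    where
    2+4k≡[1+2k]*2 : ∀ k → 2 + k * 4 ≡ (1 + k * 2) * 2
    2+4k≡[1+2k]*2 k = trans (cong (λ z → 2 + z) (sym (*-assoc k 2 2))) (sym (*-distribʳ-+ 2 1 (k * 2)))
  ... | 3 | _ | _ rewrite p%4≡ = refl
  ... | suc (suc (suc (suc _))) | s≤s (s≤s (s≤s (s≤s ()))) | _

  discOf≡1-mod-4 : ∀ {S} → All (λ p → ¬ (2 ∣ p)) S → discOf S %ℕ 4 ≡ 1
  discOf≡1-mod-4 []               = refl
  discOf≡1-mod-4 {p ∷ S} (2∤p ∷ odd) = begin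
    (Dp p ℤ.* discOf S) %ℕ 4                 ≡⟨ %ℕ-distrib-* 4 (Dp p) (discOf S) ⟩
    ((Dp p %ℕ 4) * (discOf S %ℕ 4)) % 4      ≡⟨ cong₂ (λ a b → (a * b) % 4) (Dp≡1-mod-4 2∤p) (discOf≡1-mod-4 odd) ⟩
    1                                        ∎

  ∏χ-Dp≡χ-discOf : ∀ {S} → All Prime S → ∀ n → n ≢ + 0 → prodℤ (map (λ p → χ (Dp p) n) S) ≡ χ (discOf S) n
  ∏χ-Dp≡χ-discOf [] n n≢0 = sym (begin
    kronecker (+ 1) n                                        ≡⟨ kronecker-kronProd (+ 1) n n≢0 ∣ n ∣ ≤-refl ⟩
    kronSign (+ 1) n ℤ.* kronProd (+ 1) (∣ n ∣) (∣ n ∣)      ≡⟨ cong₂ ℤ._*_ (kronSign-1 n) (∏-ε (primesUpTo ∣ n ∣) χ₁≡1) ⟩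
    + 1                                                      ∎)
    where
    open ListProduct ℤ.*-1-commutativeMonoid using (∏-ε)
    kronSign-1 : ∀ n → kronSign (+ 1) n ≡ + 1
    kronSign-1 (+ _)    = refl
    kronSign-1 -[1+ _ ] = refl
    χ₁≡1 : ∀ {p} → p ∈ primesUpTo ∣ n ∣ → kronPrime (+ 1) p ℤ.^ ν p ∣ n ∣ ≡ + 1
    χ₁≡1 {p} p∈ = trans (cong (ℤ._^ ν p ∣ n ∣) (kronPrime-1 (proj₁ (∈-primesUpTo⁻ {n = ∣ n ∣} p∈)))) (ℤ.^-zeroˡ (ν p ∣ n ∣))
  ∏χ-Dp≡χ-discOf {p ∷ S} (pp ∷ primes) n n≢0 =
    trans (cong (χ (Dp p) n ℤ.*_) (∏χ-Dp≡χ-discOf primes n n≢0))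
          (sym (kronecker-*ˡ (Dp p) (discOf S) n (Dp≢0 pp) (discOf≢0 primes) n≢0))

  -[1+n]%ℕ4≡3 : ∀ {n} → suc n % 4 ≡ 1 → -[1+ n ] %ℕ 4 ≡ 3
  -[1+n]%ℕ4≡3 n%4≡1 rewrite n%4≡1 = refl

  module FundamentalDiscriminant {D} (disc : RealOddFundDisc D) where

    0<D : 0 < D
    0<D = <-trans (s≤s z≤n) (proj₁ disc)

    D%4≡1 : D % 4 ≡ 1
    D%4≡1 = proj₁ (proj₂ disc)

    D%2≡1 : D % 2 ≡ 1
    D%2≡1 = trans (sym (m∣n⇒o%n%m≡o%m 2 4 D (divides 2 refl))) (cong (_% 2) D%4≡1)

    2∤D : ¬ (2 ∣ D)
    2∤D 2∣D with () ← trans (sym D%2≡1) (n∣m⇒m%n≡0 D 2 2∣D)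

    squarefree : ∀ p → Prime p → ¬ (p * p ∣ D)
    squarefree = proj₂ (proj₂ disc)

    ∈P⇒prime : ∀ {p} → p ∈ primeDivisors D → Prime p
    ∈P⇒prime p∈ = proj₁ (∈-primeDivisors⁻ {n = D} p∈)

    ∈P⇒∣D : ∀ {p} → p ∈ primeDivisors D → p ∣ D
    ∈P⇒∣D p∈ = proj₂ (∈-primeDivisors⁻ {n = D} p∈)

    ν-D≡1 : ∀ {q} → q ∈ primeDivisors D → ν q D ≡ 1
    ν-D≡1 {q} q∈ with ν q D | q^k∣⇒k≤ν pq 1 D 0<D (subst (_∣ D) (sym (*-identityʳ q)) (∈P⇒∣D q∈))
                            | k≤ν⇒q^k∣ pq (ν q D) D 0<D ≤-refl
      where
      pq : Prime q
      pq = ∈P⇒prime q∈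
    ... | 0           | ()     | _
    ... | 1           | _      | _        = refl
    ... | suc (suc k) | _      | q^k+2∣D = ⊥-elim (squarefree q (∈P⇒prime q∈) (∣-trans q*q∣q^k+2 q^k+2∣D))
      where
      q*q∣q^k+2 : q * q ∣ q ^ suc (suc k)
      q*q∣q^k+2 = subst (_∣ q ^ suc (suc k)) (cong (q *_) (*-identityʳ q)) (^-monoʳ-∣ q {2} {suc (suc k)} (s≤s (s≤s z≤n)))

    product-P≡D : product (primeDivisors D) ≡ D
    product-P≡D = sym (begin
      D                                               ≡⟨ ∏-prime-powers *-1-commutativeMonoid (λ n → n) refl (λ _ _ → refl)
                                                           (unique-primeDivisors D) (All.tabulate ∈P⇒prime) D 0<D
                                                           (λ p pp p∣D → ∈-primeDivisors⁺ 0<D pp p∣D) ⟩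
      ∏ (λ q → q ^ ν q D) (primeDivisors D)
        ≡⟨ ∏-cong (primeDivisors D) (λ {q} q∈ → trans (cong (q ^_) (ν-D≡1 q∈)) (*-identityʳ q)) ⟩
      ∏ (λ q → q) (primeDivisors D)                   ≡⟨ cong product (map-id (primeDivisors D)) ⟩
      product (primeDivisors D)                       ∎)
      where open ListProduct *-1-commutativeMonoid using (∏; ∏-cong)

    discOf-P≡D : discOf (primeDivisors D) ≡ + D
    discOf-P≡D with discOf (primeDivisors D) | ∣discOf∣ (primeDivisors D)
                  | discOf≡1-mod-4 (All.tabulate λ p∈ 2∣p → 2∤D (∣-trans 2∣p (∈P⇒∣D p∈)))
    ... | + n      | n≡ΠP   | _  = cong +_ (trans n≡ΠP product-P≡D)
    ... | -[1+ n ] | 1+n≡ΠP | ≡1 with () ← trans (sym (-[1+n]%ℕ4≡3 {n} (trans (cong (_% 4) (trans 1+n≡ΠP product-P≡D)) D%4≡1))) ≡1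

module MPart where

  open import Defs
  open Primes
  open Valuation
  open import Data.Nat as ℕ using (ℕ; _+_; _*_; _^_; _<_; z≤n; s≤s; NonZero)
  open import Data.Nat.Properties using (*-mono-≤; m^n>0; m^n≢0; +-identityʳ; *-identityʳ; *-assoc; ≤-reflexive)
  open import Data.Nat.Divisibility using (_∣_; divides)
  open import Data.Nat.DivMod using (m/n*n≡m; _/_)
  open import Data.Nat.Primality using (Prime; prime⇒nonZero)
  open import Data.Integer as ℤ using (ℤ; +_; ∣_∣)
  import Data.Integer.Properties as ℤ
  open import Data.Integer.Solver using (module +-*-Solver)
  open import Data.List using ([]; _∷_; _++_)
  open import Data.List.Membership.Propositional using (_∈_; _∉_)
  open import Data.List.Relation.Unary.All using (All; []; _∷_)
  open import Data.List.Relation.Unary.All.Properties using (All¬⇒¬Any)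
  open import Data.List.Relation.Unary.Any using (here; there)
  open import Data.List.Relation.Unary.Unique.Propositional using (Unique; []; _∷_)
  open import Function using (_∘_)
  open import Relation.Binary.PropositionalEquality using (_≡_; _≢_; refl; sym; trans; cong; cong₂; module ≡-Reasoning)
  open ≡-Reasoning

  module _ (m : ℤ) where

    mPart-pos : ∀ {S} → All Prime S → 0 < mPart S m
    mPart-pos []           = s≤s z≤n
    mPart-pos {p ∷ S} (pp ∷ primes) = *-mono-≤ (m^n>0 p {{prime⇒nonZero pp}} (νℤ p m)) (mPart-pos primes)

    ν-mPart-∉ : ∀ {S} → All Prime S → ∀ {q} → Prime q → q ∉ S → ν q (mPart S m) ≡ 0
    ν-mPart-∉ []                 pq _   = ν≡0 pq 1 (prime∤1 pq) (s≤s z≤n)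
    ν-mPart-∉ {p ∷ S} (pp ∷ primes) {q} pq q∉ = begin
      ν q (p ^ νℤ p m * mPart S m)           ≡⟨ ν-prime^* pp pq (q∉ ∘ here) (νℤ p m) (mPart S m) (mPart-pos primes) ⟩
      ν q (mPart S m)                        ≡⟨ ν-mPart-∉ primes pq (q∉ ∘ there) ⟩
      0                                      ∎

    ν-mPart-∈ : ∀ {S} → Unique S → All Prime S → ∀ {q} → Prime q → q ∈ S → ν q (mPart S m) ≡ νℤ q m
    ν-mPart-∈ {q ∷ S} (q∉ ∷ _) (pq ∷ primes) _ (here refl) = begin
      ν q (q ^ νℤ q m * mPart S m)
        ≡⟨ ν-* pq (q ^ νℤ q m) (mPart S m) (m^n>0 q {{prime⇒nonZero pq}} (νℤ q m)) (mPart-pos primes) ⟩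
      ν q (q ^ νℤ q m) + ν q (mPart S m)     ≡⟨ cong₂ _+_ (ν-q^ pq (νℤ q m)) (ν-mPart-∉ primes pq (All¬⇒¬Any q∉)) ⟩
      νℤ q m + 0                             ≡⟨ +-identityʳ _ ⟩
      νℤ q m                                 ∎
    ν-mPart-∈ {p ∷ S} (p∉ ∷ unique) (pp ∷ primes) {q} pq (there q∈) = begin
      ν q (p ^ νℤ p m * mPart S m)
        ≡⟨ ν-prime^* pp pq (λ { refl → All¬⇒¬Any p∉ q∈ }) (νℤ p m) (mPart S m) (mPart-pos primes) ⟩
      ν q (mPart S m)                        ≡⟨ ν-mPart-∈ unique primes pq q∈ ⟩
      νℤ q m                                 ∎

    mPart-∣ : 0 < ∣ m ∣ → ∀ {S} → Unique S → All Prime S → mPart S m ∣ ∣ m ∣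
    mPart-∣ 0<m []                        [] = divides ∣ m ∣ (sym (*-identityʳ ∣ m ∣))
    mPart-∣ 0<m {p ∷ S} (p∉ ∷ unique) (pp ∷ primes) with mPart-∣ 0<m unique primes
    ... | divides c m≡c*mS = divides (c / p ^ k) (begin
      ∣ m ∣                                  ≡⟨ m≡c*mS ⟩
      c * mPart S m                          ≡⟨ cong (_* mPart S m) (sym (m/n*n≡m p^k∣c)) ⟩
      c / p ^ k * p ^ k * mPart S m          ≡⟨ *-assoc (c / p ^ k) (p ^ k) (mPart S m) ⟩
      c / p ^ k * (p ^ k * mPart S m)        ∎)
      where
      k : ℕ
      k = νℤ p m
      instance
        p^k≢0 : NonZero (p ^ k)
        p^k≢0 = m^n≢0 p k {{prime⇒nonZero pp}}
      0<c : 0 < c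
      0<c = *≡pos⇒posˡ 0<m m≡c*mS
      p^k∣c : p ^ k ∣ c
      p^k∣c = k≤ν⇒q^k∣ pp k c 0<c (≤-reflexive (begin
        ν p ∣ m ∣                            ≡⟨ cong (ν p) m≡c*mS ⟩
        ν p (c * mPart S m)                  ≡⟨ ν-* pp c (mPart S m) 0<c (mPart-pos primes) ⟩
        ν p c + ν p (mPart S m)              ≡⟨ cong (λ z → ν p c + z) (ν-mPart-∉ primes pp (All¬⇒¬Any p∉)) ⟩
        ν p c + 0                            ≡⟨ +-identityʳ _ ⟩
        ν p c                                ∎))

  mPart-++ : ∀ S₁ S₂ m → mPart (S₁ ++ S₂) m ≡ mPart S₁ m * mPart S₂ m
  mPart-++ []       S₂ m = sym (+-identityʳ _)
  mPart-++ (p ∷ S₁) S₂ m = trans (cong (p ^ νℤ p m *_) (mPart-++ S₁ S₂ m)) (sym (*-assoc (p ^ νℤ p m) (mPart S₁ m) (mPart S₂ m)))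

module SignedQuotient where

  open import Defs using (divℤ; divℕ)
  open import Data.Nat as ℕ using (ℕ; zero; suc; _*_; _<_; _%_; _/_)
  open import Data.Nat.Properties using (*-assoc)
  open import Data.Nat.Divisibility using (_∣_; ∣n⇒∣m*n; n∣m⇒m%n≡0)
  open import Data.Nat.DivMod using (m/n*n≡m; m*n/n≡m; m*[n/m]≡n)
  open import Data.Integer as ℤ using (ℤ; +_; -[1+_]; ∣_∣)
  import Data.Integer.Properties as ℤ
  open import Data.Integer.Solver using (module +-*-Solver)
  open import Relation.Binary.PropositionalEquality using (_≡_; _≢_; refl; sym; trans; cong; module ≡-Reasoning)
  open ≡-Reasoning
  open +-*-Solver using (solve; _:*_; _:=_)

  sgn : ℤ → ℤ
  sgn (+ _)    = + 1
  sgn -[1+ _ ] = ℤ.- (+ 1)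

  sgn*∣∣ : ∀ m → m ≡ sgn m ℤ.* + ∣ m ∣
  sgn*∣∣ (+ n)     = sym (ℤ.*-identityˡ (+ n))
  sgn*∣∣ -[1+ n ]  = sym (ℤ.-1*i≡-i (+ suc n))

  sgn*≢0 : ∀ m {n} → 0 < n → sgn m ℤ.* + n ≢ + 0
  sgn*≢0 (+ _)    {suc n} _ ()
  sgn*≢0 -[1+ _ ] {suc n} _ ()

  divℤ-sgn* : ∀ m x d → 0 < d → d ∣ x → divℤ (sgn m ℤ.* + x) d ≡ sgn m ℤ.* + divℕ x d
  divℤ-sgn* (+ _)    x       (suc d) _ _   = trans (cong (λ z → divℤ z (suc d)) (ℤ.*-identityˡ (+ x))) (sym (ℤ.*-identityˡ _))
  divℤ-sgn* -[1+ _ ] zero    (suc d) _ _   = refl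
  divℤ-sgn* -[1+ _ ] (suc x) (suc d) _ d∣x =
    trans (cong (λ z → divℤ z (suc d)) (ℤ.-1*i≡-i (+ suc x)))
          (trans (-[1+x]/ℕd (n∣m⇒m%n≡0 (suc x) (suc d) d∣x)) (sym (ℤ.-1*i≡-i _)))
    where
    -[1+x]/ℕd : suc x % suc d ≡ 0 → -[1+ x ] ℤ./ℕ suc d ≡ ℤ.- (+ (suc x / suc d))
    -[1+x]/ℕd x%d≡0 rewrite x%d≡0 = refl

  *divℕ : ∀ {n} d → 0 < d → d ∣ n → d * divℕ n d ≡ n
  *divℕ (suc d) _ d∣n = m*[n/m]≡n d∣n

  divℕ-*ˡ : ∀ n x d → 0 < d → d ∣ x → divℕ (n * x) d ≡ n * divℕ x d
  divℕ-*ˡ n x (suc d) _ d∣x = begin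
    n * x / suc d                      ≡⟨ cong (λ y → n * y / suc d) (sym (m/n*n≡m d∣x)) ⟩
    n * (x / suc d * suc d) / suc d    ≡⟨ cong (_/ suc d) (sym (*-assoc n (x / suc d) (suc d))) ⟩
    n * (x / suc d) * suc d / suc d    ≡⟨ m*n/n≡m (n * (x / suc d)) (suc d) ⟩
    n * (x / suc d)                    ∎

  module _ (n : ℕ) (m : ℤ) where

    n*m/d : ∀ d → 0 < d → d ∣ ∣ m ∣ → divℤ (+ n ℤ.* m) d ≡ (sgn m ℤ.* + n) ℤ.* + divℕ ∣ m ∣ d
    n*m/d d 0<d d∣m = begin
      divℤ (+ n ℤ.* m) d                         ≡⟨ cong (λ z → divℤ (+ n ℤ.* z) d) (sgn*∣∣ m) ⟩
      divℤ (+ n ℤ.* (sgn m ℤ.* + ∣ m ∣)) d       ≡⟨ cong (λ z → divℤ z d) (trans (solve 3 (λ n s x → n :* (s :* x) := s :* (n :* x))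
                                                                                         refl (+ n) (sgn m) (+ ∣ m ∣))
                                                                                  (cong (sgn m ℤ.*_) (sym (ℤ.pos-* n ∣ m ∣)))) ⟩
      divℤ (sgn m ℤ.* + (n * ∣ m ∣)) d           ≡⟨ divℤ-sgn* m (n * ∣ m ∣) d 0<d (∣n⇒∣m*n n d∣m) ⟩
      sgn m ℤ.* + divℕ (n * ∣ m ∣) d             ≡⟨ cong (λ z → sgn m ℤ.* + z) (divℕ-*ˡ n ∣ m ∣ d 0<d d∣m) ⟩
      sgn m ℤ.* + (n * divℕ ∣ m ∣ d)             ≡⟨ cong (sgn m ℤ.*_) (ℤ.pos-* n (divℕ ∣ m ∣ d)) ⟩
      sgn m ℤ.* (+ n ℤ.* + divℕ ∣ m ∣ d)         ≡⟨ sym (ℤ.*-assoc (sgn m) (+ n) _) ⟩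
      (sgn m ℤ.* + n) ℤ.* + divℕ ∣ m ∣ d         ∎

    n*[m/d]*e : ∀ d e → 0 < d → d ∣ ∣ m ∣ → + n ℤ.* divℤ m d ℤ.* + e ≡ (sgn m ℤ.* + n) ℤ.* + (divℕ ∣ m ∣ d * e)
    n*[m/d]*e d e 0<d d∣m = begin
      + n ℤ.* divℤ m d ℤ.* + e                   ≡⟨ cong (λ z → + n ℤ.* divℤ z d ℤ.* + e) (sgn*∣∣ m) ⟩
      + n ℤ.* divℤ (sgn m ℤ.* + ∣ m ∣) d ℤ.* + e ≡⟨ cong (λ z → + n ℤ.* z ℤ.* + e) (divℤ-sgn* m ∣ m ∣ d 0<d d∣m) ⟩
      + n ℤ.* (sgn m ℤ.* + q) ℤ.* + e            ≡⟨ solve 4 (λ n s x y → n :* (s :* x) :* y := (s :* n) :* (x :* y))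
                                                          refl (+ n) (sgn m) (+ q) (+ e) ⟩
      (sgn m ℤ.* + n) ℤ.* (+ q ℤ.* + e)          ≡⟨ cong ((sgn m ℤ.* + n) ℤ.*_) (sym (ℤ.pos-* q e)) ⟩
      (sgn m ℤ.* + n) ℤ.* + (q * e)              ∎
      where
      q : ℕ
      q = divℕ ∣ m ∣ d

module CanonicalHom {c ℓ} (R : CommutativeRing c ℓ) where

  open import Defs
  open import Data.Nat as ℕ using (ℕ; zero; suc)
  import Data.Nat.Properties as ℕ
  open import Data.Integer as ℤ using (ℤ; +_; -[1+_]; +[1+_])
  import Data.Integer.Properties as ℤ
  open import Data.List using ([]; _∷_; map; upTo)
  open import Function using (_∘_)
  open import Relation.Binary.PropositionalEquality as ≡ using (_≡_)

  open CommutativeRing R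
  open Sides R
  open import Algebra.Properties.Ring ring using (-‿distribˡ-*; -‿distribʳ-*; -‿involutive; -0#≈0#)
  open import Algebra.Properties.CommutativeSemigroup *-commutativeSemigroup using (interchange)
  open import Relation.Binary.Reasoning.Setoid setoid
  open SemiringSum commutativeSemiring using (∑-cong; ∏)

  ιℕ-+ : ∀ a b → ιℕ (a ℕ.+ b) ≈ ιℕ a + ιℕ b
  ιℕ-+ zero    b = sym (+-identityˡ _)
  ιℕ-+ (suc a) b = trans (+-congˡ (ιℕ-+ a b)) (sym (+-assoc _ _ _))

  ιℕ-* : ∀ a b → ιℕ (a ℕ.* b) ≈ ιℕ a * ιℕ b
  ιℕ-* zero    b = sym (zeroˡ _)
  ιℕ-* (suc a) b = begin
    ιℕ (b ℕ.+ a ℕ.* b)             ≈⟨ ιℕ-+ b (a ℕ.* b) ⟩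
    ιℕ b + ιℕ (a ℕ.* b)            ≈⟨ +-cong (sym (*-identityˡ _)) (ιℕ-* a b) ⟩
    1# * ιℕ b + ιℕ a * ιℕ b        ≈⟨ sym (distribʳ _ _ _) ⟩
    (1# + ιℕ a) * ιℕ b             ∎

  ι-1 : ι (+ 1) ≈ 1#
  ι-1 = +-identityʳ 1#

  ι-neg : ∀ x → ι (ℤ.- x) ≈ - ι x
  ι-neg (+ zero)  = sym -0#≈0#
  ι-neg +[1+ n ]  = refl
  ι-neg -[1+ n ]  = sym (-‿involutive _)

  ι-+* : ∀ a b → ι (+ a ℤ.* + b) ≈ ιℕ a * ιℕ b
  ι-+* a b = trans (reflexive (≡.cong ι (≡.sym (ℤ.pos-* a b)))) (ιℕ-* a b)

  ι-* : ∀ x y → ι (x ℤ.* y) ≈ ι x * ι y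
  ι-* (+ a)    (+ b)    = ι-+* a b
  ι-* (+ a)    -[1+ b ] = begin
    ι (+ a ℤ.* ℤ.- (+ suc b))       ≈⟨ reflexive (≡.cong ι (≡.sym (ℤ.neg-distribʳ-* (+ a) (+ suc b)))) ⟩
    ι (ℤ.- (+ a ℤ.* + suc b))       ≈⟨ ι-neg (+ a ℤ.* + suc b) ⟩
    - ι (+ a ℤ.* + suc b)           ≈⟨ -‿cong (ι-+* a (suc b)) ⟩
    - (ιℕ a * ιℕ (suc b))           ≈⟨ -‿distribʳ-* _ _ ⟩
    ιℕ a * - ιℕ (suc b)             ∎
  ι-* -[1+ a ] (+ b)    = begin
    ι (ℤ.- (+ suc a) ℤ.* + b)       ≈⟨ reflexive (≡.cong ι (≡.sym (ℤ.neg-distribˡ-* (+ suc a) (+ b)))) ⟩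
    ι (ℤ.- (+ suc a ℤ.* + b))       ≈⟨ ι-neg (+ suc a ℤ.* + b) ⟩
    - ι (+ suc a ℤ.* + b)           ≈⟨ -‿cong (ι-+* (suc a) b) ⟩
    - (ιℕ (suc a) * ιℕ b)           ≈⟨ -‿distribˡ-* _ _ ⟩
    - ιℕ (suc a) * ιℕ b             ∎
  ι-* -[1+ a ] -[1+ b ] = begin
    ι (+ suc a ℤ.* + suc b)         ≈⟨ ι-+* (suc a) (suc b) ⟩
    ιℕ (suc a) * ιℕ (suc b)         ≈⟨ sym (-‿involutive _) ⟩
    - - (ιℕ (suc a) * ιℕ (suc b))   ≈⟨ -‿cong (-‿distribˡ-* _ _) ⟩
    - (- ιℕ (suc a) * ιℕ (suc b))   ≈⟨ -‿distribʳ-* _ _ ⟩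
    - ιℕ (suc a) * - ιℕ (suc b)     ∎

  ι-prodℤ : ∀ {A : Set} (g : A → ℤ) xs → ι (prodℤ (map g xs)) ≈ ∏ (ι ∘ g) xs
  ι-prodℤ g []       = ι-1
  ι-prodℤ g (x ∷ xs) = trans (ι-* (g x) _) (*-congˡ (ι-prodℤ g xs))

  ι²≡1 : ∀ x → x ℤ.* x ≡ + 1 → ι x * ι x ≈ 1#
  ι²≡1 x x²≡1 = trans (sym (ι-* x x)) (trans (reflexive (≡.cong ι x²≡1)) ι-1)

  pow-cong : ∀ {x y} k → x ≈ y → pow x k ≈ pow y k
  pow-cong zero    x≈y = refl
  pow-cong (suc k) x≈y = *-cong x≈y (pow-cong k x≈y)

  pow-+ : ∀ x a b → pow x (a ℕ.+ b) ≈ pow x a * pow x b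
  pow-+ x zero    b = sym (*-identityˡ _)
  pow-+ x (suc a) b = trans (*-congˡ (pow-+ x a b)) (sym (*-assoc _ _ _))

  pow-* : ∀ x y k → pow (x * y) k ≈ pow x k * pow y k
  pow-* x y zero    = sym (*-identityˡ 1#)
  pow-* x y (suc k) = trans (*-congˡ (pow-* x y k)) (interchange x y (pow x k) (pow y k))

  pow-1# : ∀ k → pow 1# k ≈ 1#
  pow-1# zero    = refl
  pow-1# (suc k) = trans (*-identityˡ _) (pow-1# k)

  ι-pow : ∀ x k → ι (x ℤ.^ k) ≈ pow (ι x) k
  ι-pow x zero    = ι-1
  ι-pow x (suc k) = trans (ι-* x (x ℤ.^ k)) (*-congˡ (ι-pow x k))

  pow-∸ : ∀ x → x * x ≈ 1# → ∀ {k i} → i ℕ.≤ k → pow x (k ℕ.∸ i) ≈ pow x k * pow x i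
  pow-∸ x x²≈1 {k} {i} i≤k = sym (begin
    pow x k * pow x i                        ≈⟨ *-congʳ (reflexive (≡.cong (pow x) (≡.sym (ℕ.m∸n+n≡m i≤k)))) ⟩
    pow x (k ℕ.∸ i ℕ.+ i) * pow x i          ≈⟨ *-congʳ (pow-+ x (k ℕ.∸ i) i) ⟩
    pow x (k ℕ.∸ i) * pow x i * pow x i      ≈⟨ *-assoc _ _ _ ⟩
    pow x (k ℕ.∸ i) * (pow x i * pow x i)    ≈⟨ *-congˡ (sym (pow-* x x i)) ⟩
    pow x (k ℕ.∸ i) * pow (x * x) i          ≈⟨ *-congˡ (trans (pow-cong i x²≈1) (pow-1# i)) ⟩
    pow x (k ℕ.∸ i) * 1#                     ≈⟨ *-identityʳ _ ⟩
    pow x (k ℕ.∸ i)                          ∎)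

  geom-cong : ∀ {x y} k → x ≈ y → geom x k ≈ geom y k
  geom-cong k x≈y = ∑-cong (upTo (suc k)) (λ {i} _ → pow-cong i x≈y)

module LocalSum {c ℓ} (R : CommutativeRing c ℓ) where

  open import Defs
  open import Data.Nat as ℕ using (ℕ; suc)
  import Data.Nat.Properties as ℕ
  open import Data.List using (_∷_; [] ; _++_; applyUpTo; upTo)
  open import Data.List.Properties using (applyUpTo-∷ʳ)
  open import Data.List.Membership.Propositional using (_∈_)
  open import Data.List.Membership.Propositional.Properties using (∈-applyUpTo⁻; ∈-upTo⁻)
  open import Data.Product using (_,_)
  open import Relation.Binary.PropositionalEquality as ≡ using (_≡_)

  open CommutativeRing R
  open Sides R
  open SemiringSum commutativeSemiring using (∑; ∑-cong; ∑-0; ∑-++; ∑-distribˡ)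
  open CanonicalHom R using (pow-*; pow-∸)
  open import Algebra.Properties.CommutativeSemigroup *-commutativeSemigroup using (x∙yz≈y∙xz)
  open import Relation.Binary.Reasoning.Setoid setoid

  localSum : Carrier → Carrier → Carrier → ℕ → Carrier
  localSum x a b k = ∑ (λ i → pow x i * (pow a i * pow b (k ℕ.∸ i))) (upTo (suc k))

  localSum-unit : ∀ x a b k → b * b ≈ 1# → localSum x a b k ≈ pow b k * geom ((a * b) * x) k
  localSum-unit x a b k b²≈1 = begin
    localSum x a b k
      ≈⟨ ∑-cong (upTo (suc k)) (λ {i} i∈ → summand i (ℕ.≤-pred (∈-upTo⁻ i∈))) ⟩
    ∑ (λ i → pow b k * pow ((a * b) * x) i) (upTo (suc k))
      ≈⟨ sym (∑-distribˡ (pow b k) (pow ((a * b) * x)) (upTo (suc k))) ⟩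
    pow b k * geom ((a * b) * x) k                    ∎
    where
    summand : ∀ i → i ℕ.≤ k → pow x i * (pow a i * pow b (k ℕ.∸ i)) ≈ pow b k * pow ((a * b) * x) i
    summand i i≤k = begin
      pow x i * (pow a i * pow b (k ℕ.∸ i))           ≈⟨ *-congˡ (*-congˡ (pow-∸ b b²≈1 i≤k)) ⟩
      pow x i * (pow a i * (pow b k * pow b i))       ≈⟨ *-congˡ (x∙yz≈y∙xz _ _ _) ⟩
      pow x i * (pow b k * (pow a i * pow b i))       ≈⟨ x∙yz≈y∙xz _ _ _ ⟩
      pow b k * (pow x i * (pow a i * pow b i))       ≈⟨ *-congˡ (*-comm _ _) ⟩
      pow b k * ((pow a i * pow b i) * pow x i)       ≈⟨ *-congˡ (*-congʳ (sym (pow-* a b i))) ⟩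
      pow b k * (pow (a * b) i * pow x i)             ≈⟨ *-congˡ (sym (pow-* (a * b) x i)) ⟩
      pow b k * pow ((a * b) * x) i                   ∎

  -- only the i = 0 term survives
  localSum-a≈0 : ∀ x a b k → a ≈ 0# → localSum x a b k ≈ pow b k
  localSum-a≈0 x a b k a≈0 = begin
    1# * (1# * pow b k) + ∑ t (applyUpTo suc k)
      ≈⟨ +-cong (trans (*-identityˡ _) (*-identityˡ _)) (∑-0 (applyUpTo suc k) t≈0) ⟩
    pow b k + 0#                                      ≈⟨ +-identityʳ _ ⟩
    pow b k                                           ∎
    where
    t : ℕ → Carrier
    t i = pow x i * (pow a i * pow b (k ℕ.∸ i))
    t≈0 : ∀ {i} → i ∈ applyUpTo suc k → t i ≈ 0#
    t≈0 i∈ with ∈-applyUpTo⁻ suc i∈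
    ... | j , _ , ≡.refl = trans (*-congˡ (trans (*-congʳ (trans (*-congʳ a≈0) (zeroˡ _))) (zeroˡ _))) (zeroʳ _)

  -- only the i = k term survives
  localSum-b≈0 : ∀ x a b k → b ≈ 0# → localSum x a b k ≈ pow a k * pow x k
  localSum-b≈0 x a b k b≈0 = begin
    localSum x a b k                    ≈⟨ reflexive (≡.cong (∑ t) (≡.sym (applyUpTo-∷ʳ (λ i → i) k))) ⟩
    ∑ t (upTo k ++ k ∷ [])              ≈⟨ ∑-++ t (upTo k) (k ∷ []) ⟩
    ∑ t (upTo k) + (t k + 0#)           ≈⟨ +-cong (∑-0 (upTo k) t≈0) (+-identityʳ _) ⟩
    0# + t k                            ≈⟨ +-identityˡ _ ⟩
    pow x k * (pow a k * pow b (k ℕ.∸ k)) ≈⟨ *-congˡ (*-congˡ (reflexive (≡.cong (pow b) (ℕ.n∸n≡0 k)))) ⟩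
    pow x k * (pow a k * 1#)            ≈⟨ trans (*-congˡ (*-identityʳ _)) (*-comm _ _) ⟩
    pow a k * pow x k                   ∎
    where
    t : ℕ → Carrier
    t i = pow x i * (pow a i * pow b (k ℕ.∸ i))
    t≈0 : ∀ {i} → i ∈ upTo k → t i ≈ 0#
    t≈0 {i} i∈ = trans (*-congˡ (trans (*-congˡ b^[k-i]≈0) (zeroʳ _))) (zeroʳ _)
      where
      b^[k-i]≈0 : pow b (k ℕ.∸ i) ≈ 0#
      b^[k-i]≈0 = trans (reflexive (≡.cong (pow b) (ℕ.+-∸-assoc 1 (∈-upTo⁻ i∈)))) (trans (*-congʳ b≈0) (zeroˡ _))

open import Defs
open ListFacts
open Primes
open Valuation
open Divisors
open KroneckerPrime using (kronPrime-*; kronPrime²)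
open Kronecker using (kronecker-+; kronecker-*ʳ; kronecker-prime; kronProd; ∣∣-pos; *-≢0)
open Discriminant
open MPart
open SignedQuotient
open import Level using (Level)
open import Data.Nat as ℕ using (ℕ; zero; suc; _<_)
import Data.Nat.Properties as ℕ
open import Data.Nat.Coprimality using (Coprime)
open import Data.Nat.Divisibility using (_∣_; _∣?_; ∣⇒≤; divides; ∣-refl; ∣-trans)

open import Data.Nat.Primality using (Prime)
open import Data.Integer as ℤ using (ℤ; +_; ∣_∣)
import Data.Integer.Properties as ℤ
open import Data.List using (List; _++_)
open import Data.List.Membership.Propositional using (_∈_; _∉_)
open import Data.List.Membership.Propositional.Properties using (∈-++⁺ˡ; ∈-++⁺ʳ; ∈-++⁻)
open import Data.List.Membership.DecPropositional ℕ._≟_ using (_∈?_)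
open import Data.List.Relation.Binary.Permutation.Propositional using (_↭_; ↭-sym; ↭⇒↭ₛ)
open import Data.List.Relation.Binary.Permutation.Propositional.Properties using (∈-resp-↭)
import Data.List.Relation.Binary.Permutation.Setoid.Properties as PermutationProperties
open import Data.List.Relation.Unary.All as All using (All)
open import Data.List.Relation.Unary.All.Properties using (++⁺)
open import Data.List.Relation.Unary.Unique.Propositional using (Unique)
open import Data.Product using (_×_; _,_; proj₁; proj₂)
open import Data.Sum using (_⊎_; inj₁; inj₂)
open import Data.Bool using (if_then_else_)
open import Data.Empty using (⊥-elim)
open import Function using (_∘_)
open import Relation.Nullary using (¬_; yes; no; does; ¬?)
open import Relation.Binary.PropositionalEquality as ≡ using (_≡_; _≢_)
open import Algebra.Bundles using (CommutativeRing)

module Identity {c ℓ : Level} (R : CommutativeRing c ℓ) (f : ℕ → CommutativeRing.Carrier R)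
  (f1≈1 : CommutativeRing._≈_ R (f 1) (CommutativeRing.1# R))
  (f-* : ∀ a b → CommutativeRing._≈_ R (f (a ℕ.* b)) (CommutativeRing._*_ R (f a) (f b)))
  {D : ℕ} (disc : RealOddFundDisc D) {N : ℕ} (0<N : 0 < N) (m : ℤ) (m≢0 : m ≢ + 0) where

  open CommutativeRing R
  open Sides R
  open SemiringSum commutativeSemiring
  open CanonicalHom R
  open LocalSum R
  open DivisorSum commutativeSemiring using (∑-divisors-∏)
  open FundamentalDiscriminant disc
  open import Algebra.Properties.CommutativeSemigroup *-commutativeSemigroup using (x∙yz≈y∙xz)
  open import Relation.Binary.Reasoning.Setoid setoid

  M : ℕ
  M = ∣ m ∣

  0<M : 0 < M
  0<M = ∣∣-pos m m≢0

  L : List ℕ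
  L = primesUpTo M

  ∈L⇒prime : ∀ {q} → q ∈ L → Prime q
  ∈L⇒prime q∈ = proj₁ (∈-primesUpTo⁻ {n = M} q∈)

  covers-∣M : ∀ {n} → n ∣ M → AllPrimeDivisorsIn n L
  covers-∣M n∣M p pp p∣n = ∈-primesUpTo⁺ pp (∣⇒≤ {{ℕ.>-nonZero 0<M}} (∣-trans p∣n n∣M))

  C : ℤ
  C = sgn m ℤ.* + N

  C≢0 : C ≢ + 0
  C≢0 = sgn*≢0 m 0<N

  f-^ : ∀ q k → f (q ℕ.^ k) ≈ pow (f q) k
  f-^ q zero    = f1≈1
  f-^ q (suc k) = trans (f-* q (q ℕ.^ k)) (*-congˡ (f-^ q k))

  f-∏ : ∀ {n} → 0 < n → n ∣ M → f n ≈ ∏ (λ q → pow (f q) (ν q n)) L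
  f-∏ {n} 0<n n∣M = trans (∏-prime-powers *-commutativeMonoid f f1≈1 f-* (unique-primesUpTo M)
                                          (All.tabulate ∈L⇒prime) n 0<n (covers-∣M n∣M))
                          (∏-cong L (λ {q} _ → f-^ q (ν q n)))

  χ-∏ : ∀ a {x} → 0 < x → x ∣ M → ι (χ a (+ x)) ≈ ∏ (λ q → pow (ι (kronPrime a q)) (ν q x)) L
  χ-∏ a {x} 0<x x∣M = begin
    ι (χ a (+ x))                                  ≡⟨ ≡.cong ι (kronecker-+ a x M 0<x (∣⇒≤ {{ℕ.>-nonZero 0<M}} x∣M)) ⟩
    ι (kronProd a x M)                             ≈⟨ ι-prodℤ (λ q → kronPrime a q ℤ.^ ν q x) L ⟩
    ∏ (λ q → ι (kronPrime a q ℤ.^ ν q x)) L        ≈⟨ ∏-cong L (λ {q} _ → ι-pow (kronPrime a q) (ν q x)) ⟩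
    ∏ (λ q → pow (ι (kronPrime a q)) (ν q x)) L    ∎

  ∏-χ-Dp : ∀ {S} → All Prime S → ∀ a → a ≢ + 0 → ∏ (λ p → ι (χ (Dp p) a)) S ≈ ι (χ (discOf S) a)
  ∏-χ-Dp {S} primes a a≢0 =
    trans (sym (ι-prodℤ (λ p → χ (Dp p) a) S)) (reflexive (≡.cong ι (∏χ-Dp≡χ-discOf primes a a≢0)))

  A B : ℕ → ℕ → Carrier
  A d p = ι (χ (Dp p) (+ d))
  B d p = ι (χ (Dp p) (divℤ (+ N ℤ.* m) d))

  module Split (S₁ S₂ : List ℕ) (S₁++S₂↭P : S₁ ++ S₂ ↭ primeDivisors D) where

    unique₁₂ : Unique (S₁ ++ S₂)
    unique₁₂ = Unique-resp-↭ (↭⇒↭ₛ (↭-sym S₁++S₂↭P)) (unique-primeDivisors D)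
      where open PermutationProperties (≡.setoid ℕ) using (Unique-resp-↭)

    unique₂ : Unique S₂
    unique₂ = proj₁ (proj₂ (Unique-++⁻ S₁ unique₁₂))

    S₁∩S₂≡∅ : ∀ {q} → q ∈ S₁ → q ∉ S₂
    S₁∩S₂≡∅ = proj₂ (proj₂ (Unique-++⁻ S₁ unique₁₂))

    ∈S₁⇒∈P : ∀ {q} → q ∈ S₁ → q ∈ primeDivisors D
    ∈S₁⇒∈P q∈ = ∈-resp-↭ S₁++S₂↭P (∈-++⁺ˡ q∈)

    ∈S₂⇒∈P : ∀ {q} → q ∈ S₂ → q ∈ primeDivisors D
    ∈S₂⇒∈P q∈ = ∈-resp-↭ S₁++S₂↭P (∈-++⁺ʳ S₁ q∈)

    ∈P⇒∈S₁⊎S₂ : ∀ {q} → q ∈ primeDivisors D → q ∈ S₁ ⊎ q ∈ S₂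
    ∈P⇒∈S₁⊎S₂ q∈ = ∈-++⁻ S₁ (∈-resp-↭ (↭-sym S₁++S₂↭P) q∈)

    primes₁ : All Prime S₁
    primes₁ = All.tabulate (∈P⇒prime ∘ ∈S₁⇒∈P)

    primes₂ : All Prime S₂
    primes₂ = All.tabulate (∈P⇒prime ∘ ∈S₂⇒∈P)

    D₁ D₂ : ℤ
    D₁ = discOf S₁
    D₂ = discOf S₂

    D₁*D₂≡D : D₁ ℤ.* D₂ ≡ + D
    D₁*D₂≡D = ≡.trans (≡.sym (ℤ∏.∏-++ Dp S₁ S₂)) (≡.trans (ℤ∏.∏-↭ Dp S₁++S₂↭P) discOf-P≡D)
      where module ℤ∏ = ListProduct ℤ.*-1-commutativeMonoid

    m₁ m₂ Y : ℕ
    m₁ = mPart S₁ m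
    m₂ = mPart S₂ m
    Y  = divℕ M (m₁ ℕ.* m₂) ℕ.* m₁

    0<m₁m₂ : 0 < m₁ ℕ.* m₂
    0<m₁m₂ = ℕ.*-mono-≤ (mPart-pos m primes₁) (mPart-pos m primes₂)

    m₁m₂∣M : m₁ ℕ.* m₂ ∣ M
    m₁m₂∣M = ≡.subst (_∣ M) (mPart-++ S₁ S₂ m) (mPart-∣ m 0<M unique₁₂ (++⁺ primes₁ primes₂))

    M≡Y*m₂ : M ≡ Y ℕ.* m₂
    M≡Y*m₂ = ≡.trans (≡.sym (*divℕ (m₁ ℕ.* m₂) 0<m₁m₂ m₁m₂∣M))
                     (≡.trans (ℕ.*-comm (m₁ ℕ.* m₂) _) (≡.sym (ℕ.*-assoc (divℕ M (m₁ ℕ.* m₂)) m₁ m₂)))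

    0<m₂ : 0 < m₂
    0<m₂ = mPart-pos m primes₂

    0<Y : 0 < Y
    0<Y = *≡pos⇒posˡ 0<M M≡Y*m₂

    m₂∣M : m₂ ∣ M
    m₂∣M = divides Y M≡Y*m₂

    Y∣M : Y ∣ M
    Y∣M = divides m₂ (≡.trans M≡Y*m₂ (ℕ.*-comm Y m₂))

    νY+νm₂ : ∀ {q} → q ∈ L → ν q Y ℕ.+ ν q m₂ ≡ ν q M
    νY+νm₂ q∈ = ≡.sym (≡.trans (≡.cong (ν _) M≡Y*m₂) (ν-* (∈L⇒prime q∈) Y m₂ 0<Y 0<m₂))

    c₁ c₂ : ℕ → ℤ
    c₁ q = kronPrime D₁ q
    c₂ q = kronPrime D₂ q

    K : Carrier
    K = ι (χ D₂ C)

    χ₁-∏ : ∀ {x} → 0 < x → x ∣ M → ∏ (λ p → ι (χ (Dp p) (+ x))) S₁ ≈ ∏ (λ q → pow (ι (c₁ q)) (ν q x)) L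
    χ₁-∏ {suc x} 0<x x∣M = trans (∏-χ-Dp primes₁ (+ suc x) (λ ())) (χ-∏ D₁ 0<x x∣M)

    χ₂-C*-∏ : ∀ {x} → 0 < x → x ∣ M → ι (χ D₂ (C ℤ.* + x)) ≈ K * ∏ (λ q → pow (ι (c₂ q)) (ν q x)) L
    χ₂-C*-∏ {suc x} 0<x x∣M = begin
      ι (χ D₂ (C ℤ.* + suc x))              ≡⟨ ≡.cong ι (kronecker-*ʳ D₂ C (+ suc x) C≢0 (λ ())) ⟩
      ι (χ D₂ C ℤ.* χ D₂ (+ suc x))         ≈⟨ ι-* (χ D₂ C) (χ D₂ (+ suc x)) ⟩
      K * ι (χ D₂ (+ suc x))                ≈⟨ *-congˡ (χ-∏ D₂ 0<x x∣M) ⟩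
      K * ∏ (λ q → pow (ι (c₂ q)) (ν q (suc x))) L ∎

    φ : ℕ → ℕ → ℕ → Carrier
    φ q i j = pow (f q) i * (pow (ι (c₁ q)) i * pow (ι (c₂ q)) j)

    summand : ∀ {d} → d ∈ divisorsℕ M →
              f d * (∏ (A d) S₁ * ∏ (B d) S₂) ≈ K * ∏ (λ q → φ q (ν q d) (ν q M ℕ.∸ ν q d)) L
    summand {d} d∈ = begin
      f d * (∏ (A d) S₁ * ∏ (B d) S₂)
        ≈⟨ *-cong (f-∏ 0<d d∣M) (*-cong (χ₁-∏ 0<d d∣M) B≈) ⟩
      ∏ (λ q → pow (f q) (ν q d)) L *
        (∏ (λ q → pow (ι (c₁ q)) (ν q d)) L * (K * ∏ (λ q → pow (ι (c₂ q)) (ν q M ℕ.∸ ν q d)) L))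
        ≈⟨ trans (*-congˡ (x∙yz≈y∙xz _ K _)) (x∙yz≈y∙xz _ K _) ⟩
      K * (∏ (λ q → pow (f q) (ν q d)) L *
             (∏ (λ q → pow (ι (c₁ q)) (ν q d)) L * ∏ (λ q → pow (ι (c₂ q)) (ν q M ℕ.∸ ν q d)) L))
        ≈⟨ *-congˡ (trans (*-congˡ (sym (∏-∙ _ _ L))) (sym (∏-∙ _ _ L))) ⟩
      K * ∏ (λ q → φ q (ν q d) (ν q M ℕ.∸ ν q d)) L ∎
      where
      d∣M : d ∣ M
      d∣M = proj₁ (∈-divisorsℕ⁻ {n = M} d∈)
      0<d : 0 < d
      0<d = proj₂ (∈-divisorsℕ⁻ {n = M} d∈)
      e : ℕ
      e = divℕ M d
      M≡d*e : M ≡ d ℕ.* e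
      M≡d*e = ≡.sym (*divℕ d 0<d d∣M)
      0<e : 0 < e
      0<e = *≡pos⇒posˡ 0<M (≡.trans M≡d*e (ℕ.*-comm d e))
      νe≡ : ∀ {q} → q ∈ L → ν q e ≡ ν q M ℕ.∸ ν q d
      νe≡ q∈ = ≡.sym (≡.trans (≡.cong (λ n → ν _ n ℕ.∸ ν _ d) M≡d*e)
                             (≡.trans (≡.cong (ℕ._∸ ν _ d) (ν-* (∈L⇒prime q∈) d e 0<d 0<e)) (ℕ.m+n∸m≡n (ν _ d) (ν _ e))))
      B≈ : ∏ (B d) S₂ ≈ K * ∏ (λ q → pow (ι (c₂ q)) (ν q M ℕ.∸ ν q d)) L
      B≈ = begin
        ∏ (B d) S₂
          ≡⟨ ≡.cong (λ a → ∏ (λ p → ι (χ (Dp p) a)) S₂) (n*m/d N m d 0<d d∣M) ⟩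
        ∏ (λ p → ι (χ (Dp p) (C ℤ.* + e))) S₂
          ≈⟨ ∏-χ-Dp primes₂ (C ℤ.* + e) (*-≢0 C (+ e) C≢0 (λ e≡0 → ℕ.<-irrefl (≡.sym (ℤ.+-injective e≡0)) 0<e)) ⟩
        ι (χ D₂ (C ℤ.* + e))                            ≈⟨ χ₂-C*-∏ 0<e (divides d M≡d*e) ⟩
        K * ∏ (λ q → pow (ι (c₂ q)) (ν q e)) L
          ≈⟨ *-congˡ (∏-cong L (λ {q} q∈ → reflexive (≡.cong (pow (ι (c₂ q))) (νe≡ q∈)))) ⟩
        K * ∏ (λ q → pow (ι (c₂ q)) (ν q M ℕ.∸ ν q d)) L ∎

    localSumAt : ℕ → Carrier
    localSumAt q = localSum (f q) (ι (c₁ q)) (ι (c₂ q)) (ν q M)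

    lhs≈ : ∑ (λ d → f d * (∏ (A d) S₁ * ∏ (B d) S₂)) (divisorsℕ M) ≈ K * ∏ localSumAt L
    lhs≈ = begin
      ∑ (λ d → f d * (∏ (A d) S₁ * ∏ (B d) S₂)) (divisorsℕ M)          ≈⟨ ∑-cong (divisorsℕ M) summand ⟩
      ∑ (λ d → K * ∏ (λ q → φ q (ν q d) (ν q M ℕ.∸ ν q d)) L) (divisorsℕ M)
                                                                         ≈⟨ sym (∑-distribˡ K _ (divisorsℕ M)) ⟩
      K * ∑ (λ d → ∏ (λ q → φ q (ν q d) (ν q M ℕ.∸ ν q d)) L) (divisorsℕ M)
                                                                         ≈⟨ *-congˡ (∑-divisors-∏ φ (unique-primesUpTo M)
                                                                                      (All.tabulate ∈L⇒prime) M 0<M (covers-∣M ∣-refl)) ⟩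
      K * ∏ localSumAt L                                                 ∎

    geomAt : ℕ → Carrier
    geomAt q = if does (¬? (q ∣? D)) then geom (ι (χ (+ D) (+ q)) * f q) (ν q M) else 1#

    ψ : ℕ → Carrier
    ψ q = pow (ι (c₁ q)) (ν q m₂) * pow (ι (c₂ q)) (ν q Y) * pow (f q) (ν q m₂) * geomAt q

    rhs≈ : term f D N m (S₁ , S₂) ≈ K * ∏ ψ L
    rhs≈ = begin
      term f D N m (S₁ , S₂)
        ≈⟨ *-cong (*-cong (*-cong (χ-∏ D₁ 0<m₂ m₂∣M)
                                  (trans (reflexive (≡.cong (λ a → ι (χ D₂ a)) (n*[m/d]*e N m (m₁ ℕ.* m₂) m₁ 0<m₁m₂ m₁m₂∣M)))
                                         (χ₂-C*-∏ 0<Y Y∣M)))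
                          (f-∏ 0<m₂ m₂∣M))
                  (∏-filter (λ p → ¬? (p ∣? D)) (λ p → geom (ι (χ (+ D) (+ p)) * f p) (ν p M)) L) ⟩
      R₁ * (K * R₂) * R₃ * R₄        ≈⟨ *-congʳ (*-congʳ (x∙yz≈y∙xz R₁ K R₂)) ⟩
      K * (R₁ * R₂) * R₃ * R₄        ≈⟨ trans (*-congʳ (*-assoc _ _ _)) (*-assoc _ _ _) ⟩
      K * (R₁ * R₂ * R₃ * R₄)
        ≈⟨ *-congˡ (sym (trans (∏-∙ _ _ L) (*-congʳ (trans (∏-∙ _ _ L) (*-congʳ (∏-∙ _ _ L)))))) ⟩
      K * ∏ ψ L                      ∎
      where
      R₁ R₂ R₃ R₄ : Carrier
      R₁ = ∏ (λ q → pow (ι (c₁ q)) (ν q m₂)) L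
      R₂ = ∏ (λ q → pow (ι (c₂ q)) (ν q Y)) L
      R₃ = ∏ (λ q → pow (f q) (ν q m₂)) L
      R₄ = ∏ geomAt L

    geomAt-∣D : ∀ {q} → q ∣ D → geomAt q ≈ 1#
    geomAt-∣D {q} q∣D with q ∣? D
    ... | yes _   = refl
    ... | no q∤D = ⊥-elim (q∤D q∣D)

    geomAt-∤D : ∀ {q} → ¬ (q ∣ D) → geomAt q ≈ geom (ι (χ (+ D) (+ q)) * f q) (ν q M)
    geomAt-∤D {q} q∤D with q ∣? D
    ... | yes q∣D = ⊥-elim (q∤D q∣D)
    ... | no _    = refl

    νY≡νM : ∀ {q} → q ∈ L → ν q m₂ ≡ 0 → ν q Y ≡ ν q M
    νY≡νM {q} q∈ νm₂≡0 = ≡.trans (≡.sym (ℕ.+-identityʳ _)) (≡.trans (≡.cong (ν q Y ℕ.+_) (≡.sym νm₂≡0)) (νY+νm₂ q∈))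

    ψ-q∤m₂ : ∀ {q} → q ∈ L → ν q m₂ ≡ 0 → ψ q ≈ pow (ι (c₂ q)) (ν q M) * geomAt q
    ψ-q∤m₂ {q} q∈ νm₂≡0 = begin
      ψ q                                                ≡⟨ ≡.cong₂ (λ i j → pow (ι (c₁ q)) i * pow (ι (c₂ q)) j * pow (f q) i * geomAt q)
                                                                    νm₂≡0 (νY≡νM q∈ νm₂≡0) ⟩
      1# * pow (ι (c₂ q)) (ν q M) * 1# * geomAt q       ≈⟨ *-congʳ (trans (*-identityʳ _) (*-identityˡ _)) ⟩
      pow (ι (c₂ q)) (ν q M) * geomAt q                  ∎

    ψ-νm₂≡νM : ∀ {q} → q ∈ L → ν q m₂ ≡ ν q M → ψ q ≈ pow (ι (c₁ q)) (ν q M) * pow (f q) (ν q M) * geomAt q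
    ψ-νm₂≡νM {q} q∈ νm₂≡νM = begin
      ψ q                                                ≡⟨ ≡.cong₂ (λ i j → pow (ι (c₁ q)) i * pow (ι (c₂ q)) j * pow (f q) i * geomAt q)
                                                                    νm₂≡νM νY≡0 ⟩
      pow (ι (c₁ q)) (ν q M) * 1# * pow (f q) (ν q M) * geomAt q
                                                         ≈⟨ *-congʳ (*-congʳ (*-identityʳ _)) ⟩
      pow (ι (c₁ q)) (ν q M) * pow (f q) (ν q M) * geomAt q ∎
      where
      νY≡0 : ν q Y ≡ 0
      νY≡0 = ℕ.+-cancelʳ-≡ (ν q m₂) (ν q Y) 0 (≡.trans (νY+νm₂ q∈) (≡.sym νm₂≡νM))

    local-∈S₁ : ∀ {q} → q ∈ L → q ∈ S₁ → localSumAt q ≈ ψ q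
    local-∈S₁ {q} q∈L q∈S₁ = begin
      localSumAt q                       ≈⟨ localSum-a≈0 (f q) (ι (c₁ q)) (ι (c₂ q)) (ν q M)
                                                         (reflexive (≡.cong ι (kronPrime-discOf-∈ (∈L⇒prime q∈L) q∈S₁))) ⟩
      pow (ι (c₂ q)) (ν q M)             ≈⟨ sym (trans (*-congˡ (geomAt-∣D (∈P⇒∣D (∈S₁⇒∈P q∈S₁)))) (*-identityʳ _)) ⟩
      pow (ι (c₂ q)) (ν q M) * geomAt q  ≈⟨ sym (ψ-q∤m₂ q∈L (ν-mPart-∉ m primes₂ (∈L⇒prime q∈L) (S₁∩S₂≡∅ q∈S₁))) ⟩
      ψ q                                ∎

    local-∈S₂ : ∀ {q} → q ∈ L → q ∈ S₂ → localSumAt q ≈ ψ q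
    local-∈S₂ {q} q∈L q∈S₂ = begin
      localSumAt q                       ≈⟨ localSum-b≈0 (f q) (ι (c₁ q)) (ι (c₂ q)) (ν q M)
                                                         (reflexive (≡.cong ι (kronPrime-discOf-∈ (∈L⇒prime q∈L) q∈S₂))) ⟩
      pow (ι (c₁ q)) (ν q M) * pow (f q) (ν q M)
                                         ≈⟨ sym (trans (*-congˡ (geomAt-∣D (∈P⇒∣D (∈S₂⇒∈P q∈S₂)))) (*-identityʳ _)) ⟩
      pow (ι (c₁ q)) (ν q M) * pow (f q) (ν q M) * geomAt q
                                         ≈⟨ sym (ψ-νm₂≡νM q∈L (ν-mPart-∈ m unique₂ primes₂ (∈L⇒prime q∈L) q∈S₂)) ⟩
      ψ q                                ∎

    local-∤D : ∀ {q} → q ∈ L → q ∉ S₁ → q ∉ S₂ → localSumAt q ≈ ψ q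
    local-∤D {q} q∈L q∉S₁ q∉S₂ = begin
      localSumAt q                   ≈⟨ localSum-unit x a b k (ι²≡1 (c₂ q) (kronPrime² pq D₂ q∤D₂)) ⟩
      pow b k * geom (a * b * x) k   ≈⟨ *-congˡ (sym (trans (geomAt-∤D q∤D) (geom-cong k (*-congʳ χD≈a*b)))) ⟩
      pow b k * geomAt q             ≈⟨ sym (ψ-q∤m₂ q∈L (ν-mPart-∉ m primes₂ pq q∉S₂)) ⟩
      ψ q                            ∎
      where
      x a b : Carrier
      x = f q
      a = ι (c₁ q)
      b = ι (c₂ q)
      k : ℕ
      k = ν q M
      pq : Prime q
      pq = ∈L⇒prime q∈L
      q∤D₂ : ¬ (q ∣ ∣ D₂ ∣)
      q∤D₂ q∣D₂ = q∉S₂ (prime∣product⇒∈ pq primes₂ (≡.subst (q ∣_) (∣discOf∣ S₂) q∣D₂))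
      q∤D : ¬ (q ∣ D)
      q∤D q∣D with ∈P⇒∈S₁⊎S₂ (∈-primeDivisors⁺ 0<D pq q∣D)
      ... | inj₁ q∈S₁ = q∉S₁ q∈S₁
      ... | inj₂ q∈S₂ = q∉S₂ q∈S₂
      χD≈a*b : ι (χ (+ D) (+ q)) ≈ a * b
      χD≈a*b = trans (reflexive (≡.cong ι (≡.trans (kronecker-prime (+ D) pq)
                                                  (≡.trans (≡.cong (λ z → kronPrime z q) (≡.sym D₁*D₂≡D))
                                                           (kronPrime-* pq D₁ D₂)))))
                     (ι-* (c₁ q) (c₂ q))

    local≈ψ : ∀ {q} → q ∈ L → localSumAt q ≈ ψ q
    local≈ψ {q} q∈L with q ∈? S₁ | q ∈? S₂
    ... | yes q∈S₁ | _        = local-∈S₁ q∈L q∈S₁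
    ... | no _     | yes q∈S₂ = local-∈S₂ q∈L q∈S₂
    ... | no q∉S₁  | no q∉S₂  = local-∤D q∈L q∉S₁ q∉S₂

    split : ∑ (λ d → f d * (∏ (A d) S₁ * ∏ (B d) S₂)) (divisorsℕ M) ≈ term f D N m (S₁ , S₂)
    split = trans lhs≈ (trans (*-congˡ (∏-cong L local≈ψ)) (sym rhs≈))

  LHS≈RHS : LHS f D N m ≈ RHS f D N m
  LHS≈RHS = begin
    ∑ (λ d → f d * ∏ (λ p → A d p + B d p) P) (divisorsℕ M)
      ≈⟨ ∑-cong (divisorsℕ M) (λ {d} _ → *-congˡ (∏-+-splits (A d) (B d) P)) ⟩
    ∑ (λ d → f d * ∑ (splitTerm d) (splits P)) (divisorsℕ M)
      ≈⟨ ∑-cong (divisorsℕ M) (λ {d} _ → ∑-distribˡ (f d) (splitTerm d) (splits P)) ⟩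
    ∑ (λ d → ∑ (λ s → f d * splitTerm d s) (splits P)) (divisorsℕ M)
      ≈⟨ ∑-comm (λ d s → f d * splitTerm d s) (divisorsℕ M) (splits P) ⟩
    ∑ (λ s → ∑ (λ d → f d * splitTerm d s) (divisorsℕ M)) (splits P)
      ≈⟨ ∑-cong (splits P) (λ {(S₁ , S₂)} s∈ → Split.split S₁ S₂ (∈-splits⇒↭ P s∈)) ⟩
    ∑ (term f D N m) (splits P) ∎
    where
    P : List ℕ
    P = primeDivisors D
    splitTerm : ℕ → List ℕ × List ℕ → Carrier
    splitTerm d s = ∏ (A d) (proj₁ s) * ∏ (B d) (proj₂ s)

open import Data.Nat using (_*_)

lemma7p5 : {c ℓ : Level} (R : CommutativeRing c ℓ)
           (f : ℕ → CommutativeRing.Carrier R)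
           → CommutativeRing._≈_ R (f 1) (CommutativeRing.1# R)
           → (∀ a b → CommutativeRing._≈_ R (f (a * b)) (CommutativeRing._*_ R (f a) (f b)))
           → (D : ℕ) → RealOddFundDisc D
           → (N : ℕ) → 0 < N → Coprime N D
           → (m : ℤ) → m ≢ + 0
           → CommutativeRing._≈_ R (Sides.LHS R f D N m) (Sides.RHS R f D N m)
lemma7p5 R f f1≈1 f-* D disc N 0<N _ m m≢0 = Identity.LHS≈RHS R f f1≈1 f-* disc 0<N m m≢0
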